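{- Let $b$ be a positive integer. For every tree $T$, in the $b$-biased Maker-Breaker domination game on $T$ with Dominator as the first player, Dominator can ensure that at the end of the game at least $\left(1-\frac{1}{(b+1)^2}\right)v(T)$ vertices of $T$ are dominated by her (i.e. are claimed by her or have a neighbour claimed by her). Moreover, this bound is sharp: there are trees $T$ with arbitrarily many vertices on which Staller can ensure that at most $\left(1-\frac{1}{(b+1)^2}+o(1)\right)v(T)$ vertices are dominated by Dominator, where $o(1)\to 0$ as $v(T)\to\infty$.
   Context: The $b$-biased Maker-Breaker domination game on a finite graph $G$: Dominator and Staller alternately claim previously unclaimed vertices of $G$ until all vertices are claimed; in each of her turns Dominator claims up to $b$ vertices, in each of his turns Staller claims one vertex. A vertex is dominated by Dominator if it or one of its neighbours is claimed by Dominator. $v(T)$ is the number of vertices of $T$. -}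

module Defs where

open import Data.Nat using (ℕ; zero; suc; _+_; _*_; _∸_; _^_; _≤_; _<_)
open import Data.Bool using (Bool; true; false; _∧_; _∨_; if_then_else_; T)
open import Data.Fin using (Fin; _≟_)
open import Data.List using (List; []; _∷_; length; filterᵇ; allFin; foldr)
open import Data.Bool.ListAction using (any)
open import Data.List.Relation.Unary.All using (All)
open import Data.List.Relation.Unary.Unique.Propositional using (Unique)
open import Data.Product using (Σ; _×_; _,_)
open import Relation.Nullary using (¬_)
open import Relation.Nullary.Decidable using (⌊_⌋)
open import Relation.Binary.PropositionalEquality using (_≡_; _≢_)

record Graph (n : ℕ) : Set where
  field
    adj   : Fin n → Fin n → Bool
    sym   : ∀ u v → adj u v ≡ adj v u
    irrefl : ∀ v → adj v v ≡ false
open Graph public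

Adj : ∀ {n} → Graph n → Fin n → Fin n → Set
Adj G u v = T (adj G u v)

data Walk {n} (G : Graph n) : Fin n → Fin n → Set where
  [_]  : ∀ v → Walk G v v
  _∷w_ : ∀ {u w v} → Adj G u w → Walk G w v → Walk G u v

Connected : ∀ {n} → Graph n → Set
Connected G = ∀ u v → Walk G u v

data Chain {n} (G : Graph n) : List (Fin n) → Set where
  nil  : Chain G []
  one  : ∀ v → Chain G (v ∷ [])
  cons : ∀ {u w vs} → Adj G u w → Chain G (w ∷ vs) → Chain G (u ∷ w ∷ vs)

record Cycle {n} (G : Graph n) : Set where
  field
    first  : Fin n
    middle : List (Fin n)
    last   : Fin n
    long   : 1 ≤ length middle
    unique : Unique (first ∷ foldr _∷_ (last ∷ []) middle)
    chain  : Chain G (first ∷ foldr _∷_ (last ∷ []) middle)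
    closes : Adj G last first

Acyclic : ∀ {n} → Graph n → Set
Acyclic G = ¬ Cycle G

IsTree : ∀ {n} → Graph n → Set
IsTree {n} G = (1 ≤ n) × Connected G × Acyclic G

data Cell : Set where
  free dom stal : Cell

Board : ℕ → Set
Board n = Fin n → Cell

emptyBoard : ∀ {n} → Board n
emptyBoard _ = free

isDom : Cell → Bool
isDom dom = true
isDom _   = false

Free : ∀ {n} → Board n → Fin n → Set
Free β v = β v ≡ free

AllClaimed : ∀ {n} → Board n → Set
AllClaimed β = ∀ v → β v ≢ free

claim : ∀ {n} → Cell → Fin n → Board n → Board n
claim c v β u = if ⌊ u ≟ v ⌋ then c else β u

claimAll : ∀ {n} → Cell → List (Fin n) → Board n → Board n
claimAll c vs β = foldr (claim c) β vs

dominated : ∀ {n} → Graph n → Board n → Fin n → Bool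
dominated {n} G β v = isDom (β v) ∨ any (λ u → adj G v u ∧ isDom (β u)) (allFin n)

domCount : ∀ {n} → Graph n → Board n → ℕ
domCount {n} G β = length (filterᵇ (dominated G β) (allFin n))

record DomMove {n} (b : ℕ) (β : Board n) : Set where
  field
    verts    : List (Fin n)
    nonempty : 1 ≤ length verts
    atMost   : length verts ≤ b
    distinct : Unique verts
    allFree  : All (Free β) verts
open DomMove public

data Turn : Set where
  dominatorTurn stallerTurn : Turn

-- Winning (= "can ensure") predicates, defined inductively over the
-- finite game tree.  P is a property of the final board.

data DomEnsures {n} (G : Graph n) (b : ℕ) (P : Board n → Set)
     : Turn → Board n → Set where
  over  : ∀ {t β} → AllClaimed β → P β → DomEnsures G b P t β
  dMove : ∀ {β} → ¬ AllClaimed β → (m : DomMove b β) →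
          DomEnsures G b P stallerTurn (claimAll dom (verts m) β) →
          DomEnsures G b P dominatorTurn β
  sMove : ∀ {β} → ¬ AllClaimed β →
          (∀ v → Free β v → DomEnsures G b P dominatorTurn (claim stal v β)) →
          DomEnsures G b P stallerTurn β

data StalEnsures {n} (G : Graph n) (b : ℕ) (P : Board n → Set)
     : Turn → Board n → Set where
  over  : ∀ {t β} → AllClaimed β → P β → StalEnsures G b P t β
  dMove : ∀ {β} → ¬ AllClaimed β →
          (∀ (m : DomMove b β) →
             StalEnsures G b P stallerTurn (claimAll dom (verts m) β)) →
          StalEnsures G b P dominatorTurn β
  sMove : ∀ {β} → ¬ AllClaimed β → (v : Fin n) → Free β v →
          StalEnsures G b P dominatorTurn (claim stal v β) →
          StalEnsures G b P stallerTurn β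

{-# OPTIONS --safe #-}
-- Dominator's side is an Erdős–Selfridge argument.  An undominated vertex u with k free vertices in its
-- closed neighbourhood N[u] carries the weight (b+1)^(-k).  Dominator claims, one after another, b free
-- vertices of maximal load (the total weight of the neighbourhoods through the vertex): each claim removes
-- the weight of those neighbourhoods, while Staller's next claim at most multiplies the weight of the
-- neighbourhoods through it by b+1.  So the total weight never increases.  In a tree with at least two
-- vertices every |N[u]| ≥ 2, so the total starts at most n/(b+1)², and at the end it is the number of
-- undominated vertices.
--
-- Staller's side uses the star of stars: a hub joined to t centres, each carrying t leaves.  Staller claims
-- free centres while there are any, then free leaves of his own centres.  As Dominator claims at most b
-- vertices per round, Staller gets about t/(b+1) of the centres and about a 1/(b+1) share of the leaves
-- below them; those leaves stay undominated, about t²/(b+1)² of the t² + t + 1 vertices.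
module Submission where

open import Defs hiding (sym)
open import Data.Nat using (ℕ; suc; _+_; _*_; _∸_; _^_; _≤_)
open import Data.Product using (Σ; _×_)

open import Data.Bool.Base using (Bool; true; false; T; not; _∧_; _∨_; if_then_else_)
open import Data.Bool.ListAction using (or)
open import Data.Bool.Properties using (T-∧; T-∨; T-≡; T?; ∧-identityʳ)
open import Data.Empty using (⊥-elim)
open import Data.Fin using (Fin; _≟_; combine; remQuot) renaming (zero to fzero; suc to fsuc)
open import Data.Fin.Properties using (any?; remQuot-combine; combine-remQuot)
open import Data.List.Base as List using (List; []; _∷_; length; allFin; filter; filterᵇ; foldr)
open import Data.List.Extrema.Nat using (argmax; argmax-all; f[xs]≤f[argmax])
open import Data.List.Membership.Propositional using (_∈_; lose)
open import Data.List.Membership.Propositional.Properties using (∈-allFin; ∈-filter⁺)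
open import Data.List.Properties using (length-tabulate; map-cong)
open import Data.List.Relation.Unary.All as All using (All; []; _∷_)
import Data.List.Relation.Unary.All.Properties as Allₚ
open import Data.List.Relation.Unary.AllPairs using ([]; _∷_)
open import Data.List.Relation.Unary.Any using (here; there; satisfied)
open import Data.List.Relation.Unary.Any.Properties using (any⁺; any⁻)
open import Data.List.Relation.Unary.Unique.Propositional using (Unique)
import Data.List.Relation.Unary.Unique.Propositional.Properties as Uniqueₚ
open import Data.Nat.Base using (zero; _<_; z≤n; s≤s; NonZero; >-nonZero)
open import Data.Nat.Induction using (<-wellFounded)
open import Data.Nat.Properties hiding (_≟_)
open import Algebra.Properties.CommutativeSemigroup +-commutativeSemigroup using (interchange; x∙yz≈y∙xz)
open import Data.Nat.Tactic.RingSolver using (solve-∀)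
open import Data.Product using (∃; _,_; proj₁; proj₂; uncurry)
open import Data.Sum using (_⊎_; inj₁; inj₂; [_,_]′)
open import Function using (_∘_; id; Equivalence)
open import Induction.WellFounded using (Acc; acc)
open import Relation.Binary.Definitions using (DecidableEquality)
open import Relation.Binary.PropositionalEquality
open import Relation.Nullary using (¬_; Dec; yes; no)
open import Relation.Nullary.Decidable using (⌊_⌋; _×-dec_; toWitness; fromWitness; fromWitnessFalse)

𝟙 : Bool → ℕ
𝟙 true = 1
𝟙 false = 0

𝟙≤1 : ∀ x → 𝟙 x ≤ 1
𝟙≤1 true = ≤-refl
𝟙≤1 false = z≤n

𝟙-false : ∀ {x} → ¬ T x → 𝟙 x ≡ 0
𝟙-false {false} _ = refl
𝟙-false {true} ¬x = ⊥-elim (¬x _)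

𝟙-true : ∀ {x} → T x → 𝟙 x ≡ 1
𝟙-true {true} _ = refl

𝟙-mono : ∀ {x y} → (T x → T y) → 𝟙 x ≤ 𝟙 y
𝟙-mono {false} _ = z≤n
𝟙-mono {true} {true} _ = ≤-refl
𝟙-mono {true} {false} x⇒y = ⊥-elim (x⇒y _)

∧-mono-T : ∀ {a a′ b b′} → (T a → T a′) → (T b → T b′) → T (a ∧ b) → T (a′ ∧ b′)
∧-mono-T {true} {true} {true} {true} _ _ _ = _
∧-mono-T {true} {false} {true} a⇒a′ _ _ = a⇒a′ _
∧-mono-T {true} {true} {true} {false} _ b⇒b′ _ = b⇒b′ _

not-anti-T : ∀ {a b} → (T a → T b) → T (not b) → T (not a)
not-anti-T {false} _ _ = _
not-anti-T {true} {true} _ ()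
not-anti-T {true} {false} a⇒b _ = a⇒b _

¬T⇒T-not : ∀ {a} → ¬ T a → T (not a)
¬T⇒T-not {false} _ = _
¬T⇒T-not {true} ¬a = ¬a _

∧-proj₁ : ∀ {a c} → T (a ∧ c) → T a
∧-proj₁ = proj₁ ∘ Equivalence.to T-∧

∧-proj₂ : ∀ {a c} → T (a ∧ c) → T c
∧-proj₂ = proj₂ ∘ Equivalence.to T-∧

module _ {A : Set} where

  ∑ : List A → (A → ℕ) → ℕ
  ∑ [] f = 0
  ∑ (x ∷ xs) f = f x + ∑ xs f

  syntax ∑ xs (λ x → e) = ∑[ x ∈ xs ] e

  count : (A → Bool) → List A → ℕ
  count p xs = ∑[ x ∈ xs ] 𝟙 (p x)

  ∑-cong : ∀ {f g : A → ℕ} → (∀ x → f x ≡ g x) → ∀ xs → ∑ xs f ≡ ∑ xs g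
  ∑-cong f≗g [] = refl
  ∑-cong f≗g (x ∷ xs) = cong₂ _+_ (f≗g x) (∑-cong f≗g xs)

  ∑-mono-≤ : ∀ {f g : A → ℕ} → (∀ x → f x ≤ g x) → ∀ xs → ∑ xs f ≤ ∑ xs g
  ∑-mono-≤ f≤g [] = z≤n
  ∑-mono-≤ f≤g (x ∷ xs) = +-mono-≤ (f≤g x) (∑-mono-≤ f≤g xs)

  ∑-+ : ∀ (f g : A → ℕ) xs → ∑[ x ∈ xs ] (f x + g x) ≡ ∑ xs f + ∑ xs g
  ∑-+ f g [] = refl
  ∑-+ f g (x ∷ xs) = trans (cong (f x + g x +_) (∑-+ f g xs)) (interchange (f x) (g x) _ _)

  ∑-*ˡ : ∀ c (f : A → ℕ) xs → ∑[ x ∈ xs ] (c * f x) ≡ c * ∑ xs f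
  ∑-*ˡ c f [] = sym (*-zeroʳ c)
  ∑-*ˡ c f (x ∷ xs) = trans (cong (c * f x +_) (∑-*ˡ c f xs)) (sym (*-distribˡ-+ c (f x) _))

  ∑-bounded : ∀ {f : A → ℕ} c → (∀ x → f x ≤ c) → ∀ xs → ∑ xs f ≤ length xs * c
  ∑-bounded c f≤c [] = z≤n
  ∑-bounded c f≤c (x ∷ xs) = +-mono-≤ (f≤c x) (∑-bounded c f≤c xs)

  ∑-gain : ∀ {f g : A → ℕ} {z c xs} → (∀ x → f x ≤ g x) → c + f z ≤ g z → z ∈ xs →
           c + ∑ xs f ≤ ∑ xs g
  ∑-gain {f} {g} {z} {c} {_ ∷ xs} f≤g c+fz≤gz (here refl) =
    subst (_≤ ∑ (z ∷ xs) g) (+-assoc c (f z) _) (+-mono-≤ c+fz≤gz (∑-mono-≤ f≤g xs))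
  ∑-gain {f} {g} {c = c} {x ∷ xs} f≤g c+fz≤gz (there z∈xs) =
    subst (_≤ ∑ (x ∷ xs) g) (x∙yz≈y∙xz (f x) c _) (+-mono-≤ (f≤g x) (∑-gain f≤g c+fz≤gz z∈xs))

  count≤length : ∀ p xs → count p xs ≤ length xs
  count≤length p xs = subst (count p xs ≤_) (*-identityʳ (length xs)) (∑-bounded 1 (λ x → 𝟙≤1 (p x)) xs)

  length-filterᵇ : ∀ (p : A → Bool) xs → length (filterᵇ p xs) ≡ count p xs
  length-filterᵇ p [] = refl
  length-filterᵇ p (x ∷ xs) with p x
  ... | true = cong suc (length-filterᵇ p xs)
  ... | false = length-filterᵇ p xs

  count+count-not : ∀ (p : A → Bool) xs → count p xs + count (not ∘ p) xs ≡ length xs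
  count+count-not p [] = refl
  count+count-not p (x ∷ xs) with p x
  ... | true = cong suc (count+count-not p xs)
  ... | false = trans (+-suc _ _) (cong suc (count+count-not p xs))

  count-none : ∀ {p : A → Bool} xs → (∀ x → ¬ T (p x)) → count p xs ≡ 0
  count-none [] _ = refl
  count-none {p} (x ∷ xs) ¬p with p x in px
  ... | true = ⊥-elim (¬p x (subst T (sym px) _))
  ... | false = count-none xs ¬p

  module _ (_≟_ : DecidableEquality A) where

    ∑-except : ∀ {f g : A → ℕ} z → (∀ x → ¬ x ≡ z → f x ≤ g x) → ∀ {xs} → Unique xs →
               ∑ xs f ≤ f z + ∑ xs g
    ∑-except z f≤g {[]} [] = z≤n
    ∑-except {f} {g} z f≤g {x ∷ xs} (x∉xs ∷ xs!) with x ≟ z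
    ... | yes refl = +-monoʳ-≤ (f x) (≤-trans (∑-mono-All x∉xs) (m≤n+m _ (g x)))
      where
      ∑-mono-All : ∀ {ys} → All (λ y → ¬ x ≡ y) ys → ∑ ys f ≤ ∑ ys g
      ∑-mono-All [] = z≤n
      ∑-mono-All (x≢y ∷ x∉ys) = +-mono-≤ (f≤g _ (λ y≡x → x≢y (sym y≡x))) (∑-mono-All x∉ys)
    ... | no x≢z = subst (f x + ∑ xs f ≤_) (x∙yz≈y∙xz (g x) (f z) _)
                         (+-mono-≤ (f≤g x x≢z) (∑-except z f≤g xs!))

    length≤count : ∀ {p : A → Bool} {xs ys} → Unique ys → All (λ y → y ∈ xs × T (p y)) ys →
                   length ys ≤ count p xs
    length≤count [] [] = z≤n
    length≤count {p} {xs} {y ∷ ys} (y∉ys ∷ ys!) ((y∈xs , py) ∷ ys⊆p) =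
      ≤-trans (s≤s (length≤count ys! (All.zipWith keep (y∉ys , ys⊆p))))
              (∑-gain (λ x → 𝟙-mono ∧-proj₁) (lose-y py) y∈xs)
      where
      p∖y : A → Bool
      p∖y x = p x ∧ not ⌊ x ≟ y ⌋
      keep : ∀ {x} → ¬ y ≡ x × (x ∈ xs × T (p x)) → x ∈ xs × T (p∖y x)
      keep (y≢x , x∈xs , px) = x∈xs , Equivalence.from T-∧ (px , fromWitnessFalse (y≢x ∘ sym))
      lose-y : T (p y) → 1 + 𝟙 (p∖y y) ≤ 𝟙 (p y)
      lose-y py with y ≟ y | p y
      ... | yes _ | true = ≤-refl
      ... | no y≢y | _ = ⊥-elim (y≢y refl)

    count-update : ∀ {p p′ : A → Bool} z → (∀ x → ¬ x ≡ z → p′ x ≡ p x) → ¬ T (p z) →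
                   ∀ {xs} → Unique xs → z ∈ xs →
                   count p′ xs ≡ 𝟙 (p′ z) + count p xs
    count-update {p} {p′} z same ¬pz xs! z∈xs = ≤-antisym
      (∑-except z (λ x x≢z → ≤-reflexive (cong 𝟙 (same x x≢z))) xs!)
      (∑-gain everywhere (≤-reflexive (trans (cong (𝟙 (p′ z) +_) (𝟙-false ¬pz)) (+-identityʳ _))) z∈xs)
      where
      everywhere : ∀ x → 𝟙 (p x) ≤ 𝟙 (p′ x)
      everywhere x with x ≟ z
      ... | yes refl = 𝟙-mono (λ pz → ⊥-elim (¬pz pz))
      ... | no x≢z = ≤-reflexive (cong 𝟙 (sym (same x x≢z)))

length-allFin : ∀ n → length (allFin n) ≡ n
length-allFin n = length-tabulate {n = n} (λ v → v)

injection⇒≤count : ∀ {m N} (p : Fin N → Bool) (f : Fin m → Fin N) → (∀ {i j} → f i ≡ f j → i ≡ j) →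
                   (∀ i → T (p (f i))) → m ≤ count p (allFin N)
injection⇒≤count p f f-injective pf =
  subst (_≤ _) (length-tabulate f)
        (length≤count _≟_ (Uniqueₚ.tabulate⁺ f-injective) (Allₚ.tabulate⁺ λ i → ∈-allFin (f i) , pf i))

isFree isStal : Cell → Bool
isFree free = true
isFree _ = false
isStal stal = true
isStal _ = false

free? : (c : Cell) → Dec (c ≡ free)
free? free = yes refl
free? dom = no λ ()
free? stal = no λ ()

module _ {n : ℕ} where

  claim-same : ∀ c v (β : Board n) → claim c v β v ≡ c
  claim-same c v β with v ≟ v
  ... | yes _ = refl
  ... | no v≢v = ⊥-elim (v≢v refl)

  claim-other : ∀ c {v u} (β : Board n) → ¬ u ≡ v → claim c v β u ≡ β u
  claim-other c {v} {u} β u≢v with u ≟ v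
  ... | yes u≡v = ⊥-elim (u≢v u≡v)
  ... | no _ = refl

  claim-free⁻ : ∀ {c} (β : Board n) v u → ¬ c ≡ free → Free (claim c v β) u → Free β u
  claim-free⁻ β v u c≢free u-free with u ≟ v
  ... | yes refl = ⊥-elim (c≢free u-free)
  ... | no _ = u-free

  claimAll-free⁻ : ∀ {c} ys (β : Board n) u → ¬ c ≡ free → Free (claimAll c ys β) u → Free β u
  claimAll-free⁻ [] β u _ u-free = u-free
  claimAll-free⁻ (y ∷ ys) β u c≢free u-free =
    claimAll-free⁻ ys β u c≢free (claim-free⁻ (claimAll _ ys β) y u c≢free u-free)

  claimAll-∈ : ∀ c {ys y} (β : Board n) → y ∈ ys → claimAll c ys β y ≡ c
  claimAll-∈ c {y ∷ ys} β (here refl) = claim-same c y (claimAll c ys β)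
  claimAll-∈ c {y′ ∷ ys} {y} β (there y∈ys) with y ≟ y′
  ... | yes _ = refl
  ... | no _ = claimAll-∈ c β y∈ys

  claimAll-∉ : ∀ c {ys y} (β : Board n) → All (λ x → ¬ y ≡ x) ys → claimAll c ys β y ≡ β y
  claimAll-∉ c β [] = refl
  claimAll-∉ c {x ∷ ys} β (y≢x ∷ y∉ys) = trans (claim-other c (claimAll c ys β) y≢x) (claimAll-∉ c β y∉ys)

  claim-preserves : ∀ (q : Cell → Bool) {c z} (β : Board n) → q c ≡ q (β z) →
                    ∀ v → q (claim c z β v) ≡ q (β v)
  claim-preserves q {z = z} β same v with v ≟ z
  ... | yes refl = same
  ... | no _ = refl

  claimAll-preserves : ∀ (q : Cell → Bool) {c} ys (β : Board n) → q c ≡ q free → All (Free β) ys →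
                       ∀ v → q (claimAll c ys β v) ≡ q (β v)
  claimAll-preserves q [] β _ _ v = refl
  claimAll-preserves q (y ∷ ys) β same (y-free ∷ ys-free) v =
    trans (claim-preserves q (claimAll _ ys β) (trans same (sym (trans earlier (cong q y-free)))) v) earlier′
    where
    earlier : q (claimAll _ ys β y) ≡ q (β y)
    earlier = claimAll-preserves q ys β same ys-free y
    earlier′ : q (claimAll _ ys β v) ≡ q (β v)
    earlier′ = claimAll-preserves q ys β same ys-free v

  claim-mono : ∀ (q : Cell → Bool) {c z} (β : Board n) → T (q c) → ∀ v → T (q (β v)) → T (q (claim c z β v))
  claim-mono q {z = z} β qc v qv with v ≟ z
  ... | yes refl = qc
  ... | no _ = qv

  freeVertex? : (β : Board n) → AllClaimed β ⊎ ∃ (Free β)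
  freeVertex? β with any? (λ v → free? (β v))
  ... | yes v-free = inj₂ v-free
  ... | no none = inj₁ λ v v-free → none (v , v-free)

  freeCount : Board n → ℕ
  freeCount β = count (isFree ∘ β) (allFin n)

  freeCount-claimAll : ∀ {c} ys (β : Board n) {y} → ¬ c ≡ free → y ∈ ys → Free β y →
                       freeCount (claimAll c ys β) < freeCount β
  freeCount-claimAll {c} ys β {y} c≢free y∈ys y-free =
    ∑-gain (λ v → 𝟙-mono (stays-claimed v)) lost (∈-allFin y)
    where
    stays-claimed : ∀ v → T (isFree (claimAll c ys β v)) → T (isFree (β v))
    stays-claimed v with claimAll c ys β v in eq
    ... | free rewrite claimAll-free⁻ ys β v c≢free eq = _
    lost : 1 + 𝟙 (isFree (claimAll c ys β y)) ≤ 𝟙 (isFree (β y))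
    lost rewrite claimAll-∈ c β y∈ys | y-free = claimed c≢free
      where
      claimed : ∀ {c} → ¬ c ≡ free → 1 + 𝟙 (isFree c) ≤ 1
      claimed {free} c≢free = ⊥-elim (c≢free refl)
      claimed {dom} _ = ≤-refl
      claimed {stal} _ = ≤-refl

module _ {n} {G : Graph n} {b : ℕ} {P Q : Board n → Set} (P⇒Q : ∀ {β} → P β → Q β) where

  DomEnsures-map : ∀ {t β} → DomEnsures G b P t β → DomEnsures G b Q t β
  DomEnsures-map (over done p) = over done (P⇒Q p)
  DomEnsures-map (dMove ongoing m next) = dMove ongoing m (DomEnsures-map next)
  DomEnsures-map (sMove ongoing next) = sMove ongoing λ v v-free → DomEnsures-map (next v v-free)

  StalEnsures-map : ∀ {t β} → StalEnsures G b P t β → StalEnsures G b Q t β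
  StalEnsures-map (over done p) = over done (P⇒Q p)
  StalEnsures-map (dMove ongoing next) = dMove ongoing λ m → StalEnsures-map (next m)
  StalEnsures-map (sMove ongoing v v-free next) = sMove ongoing v v-free (StalEnsures-map next)

-- Iᵈ and Iˢ are the invariants of positions with Dominator, respectively Staller, to move.
module Strategy {n} (G : Graph n) (b : ℕ) (P : Board n → Set) (Iᵈ Iˢ : Board n → Set)
  (endᵈ : ∀ {β} → AllClaimed β → Iᵈ β → P β) (endˢ : ∀ {β} → AllClaimed β → Iˢ β → P β) where

  dominatorEnsures :
    (∀ {β v} → Iᵈ β → Free β v → Σ (DomMove b β) λ m → Iˢ (claimAll dom (verts m) β)) →
    (∀ {β v} → Iˢ β → Free β v → Iᵈ (claim stal v β)) →
    ∀ {β} → Iᵈ β → DomEnsures G b P dominatorTurn β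
  dominatorEnsures move reply {β} = dominatorTurn′ (<-wellFounded (freeCount β))
    where
    dominatorTurn′ : ∀ {β} → Acc _<_ (freeCount β) → Iᵈ β → DomEnsures G b P dominatorTurn β
    stallerTurn′ : ∀ {β} → Acc _<_ (freeCount β) → Iˢ β → DomEnsures G b P stallerTurn β
    dominatorTurn′ {β} (acc smaller) i with freeVertex? β
    ... | inj₁ done = over done (endᵈ done i)
    ... | inj₂ (v , v-free) with move i v-free
    ...   | m@record { verts = ys@(_ ∷ _) ; allFree = y-free ∷ _ } , i′ =
            dMove (λ done → done v v-free) m
                  (stallerTurn′ (smaller (freeCount-claimAll ys β (λ ()) (here refl) y-free)) i′)
    stallerTurn′ {β} (acc smaller) i with freeVertex? β
    ... | inj₁ done = over done (endˢ done i)
    ... | inj₂ (v , v-free) = sMove (λ done → done v v-free) λ z z-free →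
            dominatorTurn′ (smaller (freeCount-claimAll (z ∷ []) β (λ ()) (here refl) z-free)) (reply i z-free)

  stallerEnsures :
    (∀ {β} → Iᵈ β → (m : DomMove b β) → Iˢ (claimAll dom (verts m) β)) →
    (∀ {β v} → Iˢ β → Free β v → Σ (Fin n) λ z → Free β z × Iᵈ (claim stal z β)) →
    ∀ {β} → Iᵈ β → StalEnsures G b P dominatorTurn β
  stallerEnsures reply move {β} = dominatorTurn′ (<-wellFounded (freeCount β))
    where
    dominatorTurn′ : ∀ {β} → Acc _<_ (freeCount β) → Iᵈ β → StalEnsures G b P dominatorTurn β
    stallerTurn′ : ∀ {β} → Acc _<_ (freeCount β) → Iˢ β → StalEnsures G b P stallerTurn β
    dominatorTurn′ {β} (acc smaller) i with freeVertex? β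
    ... | inj₁ done = over done (endᵈ done i)
    ... | inj₂ (v , v-free) = dMove (λ done → done v v-free) λ where
            m@record { verts = ys@(_ ∷ _) ; allFree = y-free ∷ _ } →
              stallerTurn′ (smaller (freeCount-claimAll ys β (λ ()) (here refl) y-free)) (reply i m)
    stallerTurn′ {β} (acc smaller) i with freeVertex? β
    ... | inj₁ done = over done (endˢ done i)
    ... | inj₂ (v , v-free) with move i v-free
    ...   | z , z-free , i′ = sMove (λ done → done v v-free) z z-free
              (dominatorTurn′ (smaller (freeCount-claimAll (z ∷ []) β (λ ()) (here refl) z-free)) i′)

module _ {n} (f : Board n → ℕ) (Frozen : Board n → Set)
  (step : ∀ {β y} → Free β y → f (claim dom y β) ≤ suc (f β))
  (frozen-step : ∀ {β y} → Free β y → Frozen β → f (claim dom y β) ≤ f β × Frozen (claim dom y β)) where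

  claimAll-dom-≤ : ∀ {ys β} → Unique ys → All (Free β) ys → f (claimAll dom ys β) ≤ length ys + f β
  claimAll-dom-≤ [] [] = ≤-refl
  claimAll-dom-≤ {y ∷ ys} {β} (y∉ys ∷ ys!) (y-free ∷ ys-free) =
    ≤-trans (step (trans (claimAll-∉ dom β y∉ys) y-free)) (s≤s (claimAll-dom-≤ ys! ys-free))

  claimAll-dom-frozen : ∀ {ys β} → Unique ys → All (Free β) ys → Frozen β →
                        f (claimAll dom ys β) ≤ f β × Frozen (claimAll dom ys β)
  claimAll-dom-frozen [] [] frozen = ≤-refl , frozen
  claimAll-dom-frozen {y ∷ ys} {β} (y∉ys ∷ ys!) (y-free ∷ ys-free) frozen
    with claimAll-dom-frozen ys! ys-free frozen
  ... | f≤ , frozen′ with frozen-step (trans (claimAll-∉ dom β y∉ys) y-free) frozen′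
  ...   | f≤′ , frozen″ = ≤-trans f≤′ f≤ , frozen″

  domMove-bound : ∀ {b β x} (m : DomMove b β) → f β ≤ x ⊎ Frozen β → f β ≤ x + b →
                  f (claimAll dom (verts m) β) ≤ x + b
  domMove-bound {b} {β} {x} m (inj₁ f≤x) _ =
    ≤-trans (claimAll-dom-≤ (distinct m) (allFree m))
            (subst (length (verts m) + f β ≤_) (+-comm b x) (+-mono-≤ (atMost m) f≤x))
  domMove-bound m (inj₂ frozen) f≤x+b = ≤-trans (proj₁ (claimAll-dom-frozen (distinct m) (allFree m) frozen)) f≤x+b

-- Dominator's potential strategy

module _ {n : ℕ} (G : Graph n) where

  closedNbhd : Fin n → Fin n → Bool
  closedNbhd u v = ⌊ u ≟ v ⌋ ∨ adj G u v

  closedNbhdSize : Fin n → ℕ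
  closedNbhdSize u = count (closedNbhd u) (allFin n)

  undominated : Board n → ℕ
  undominated β = count (not ∘ dominated G β) (allFin n)

  closedNbhd-self : ∀ u → T (closedNbhd u u)
  closedNbhd-self u with u ≟ u
  ... | yes _ = _
  ... | no u≢u = ⊥-elim (u≢u refl)

  closedNbhd-adj : ∀ {u v} → T (adj G u v) → T (closedNbhd u v)
  closedNbhd-adj u~v = Equivalence.from T-∨ (inj₂ u~v)

  dominated-cong : ∀ {β β′ : Board n} u → (∀ v → T (closedNbhd u v) → isDom (β v) ≡ isDom (β′ v)) →
                   dominated G β u ≡ dominated G β′ u
  dominated-cong {β} {β′} u same = cong₂ _∨_ (same u (closedNbhd-self u)) (cong or (map-cong neighbour (allFin n)))
    where
    neighbour : ∀ w → (adj G u w ∧ isDom (β w)) ≡ (adj G u w ∧ isDom (β′ w))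
    neighbour w with adj G u w in u~w
    ... | true = same w (closedNbhd-adj (Equivalence.from T-≡ u~w))
    ... | false = refl

  dominated-claim-dom : ∀ (β : Board n) {u y} → T (closedNbhd u y) → T (dominated G (claim dom y β) u)
  dominated-claim-dom β {u} {y} y∈N[u] with u ≟ y
  ... | yes refl = _
  ... | no _ = Equivalence.from T-∨ (inj₂ (any⁺ _ (lose (∈-allFin y) (witness y∈N[u]))))
    where
    witness : T (adj G u y) → T (adj G u y ∧ isDom (claim dom y β y))
    witness u~y rewrite Equivalence.to T-≡ u~y | claim-same dom y β = _

  domCount+undominated : ∀ β → domCount G β + undominated β ≡ n
  domCount+undominated β = trans (cong (_+ undominated β) (length-filterᵇ (dominated G β) (allFin n)))
                           (trans (count+count-not (dominated G β) (allFin n)) (length-allFin n))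

module ErdősSelfridge {n : ℕ} (G : Graph n) (b : ℕ) where

  freeIn : Board n → Fin n → ℕ
  freeIn β u = count (λ v → closedNbhd G u v ∧ isFree (β v)) (allFin n)

  -- The weight (b+1)^(-k) of an undominated vertex with k free vertices around it, scaled by (b+1)^n.
  threat : Bool → ℕ → ℕ
  threat true _ = 0
  threat false k = suc b ^ (n ∸ k)

  danger : Board n → Fin n → ℕ
  danger β u = threat (dominated G β u) (freeIn β u)

  potential : Board n → ℕ
  potential β = ∑[ u ∈ allFin n ] danger β u

  share : Board n → Fin n → Fin n → ℕ
  share β z u = if closedNbhd G u z then danger β u else 0

  load : Board n → Fin n → ℕ
  load β z = ∑[ u ∈ allFin n ] share β z u

  danger-cong : ∀ {β β′ : Board n} u → (∀ v → T (closedNbhd G u v) → β v ≡ β′ v) →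
                danger β u ≡ danger β′ u
  danger-cong {β} {β′} u same = cong₂ threat (dominated-cong G u (λ v v∈N[u] → cong isDom (same v v∈N[u])))
                                    (∑-cong free∩N[u] (allFin n))
    where
    free∩N[u] : ∀ v → 𝟙 (closedNbhd G u v ∧ isFree (β v)) ≡ 𝟙 (closedNbhd G u v ∧ isFree (β′ v))
    free∩N[u] v with closedNbhd G u v in v∈N[u]
    ... | true = cong (𝟙 ∘ isFree) (same v (subst T (sym v∈N[u]) _))
    ... | false = refl

  threat-dominated : ∀ {d} k → T d → threat d k ≡ 0
  threat-dominated {true} k _ = refl

  threat-step : ∀ d {k k′} → k ≤ suc k′ → threat d k′ ≤ suc b * threat d k
  threat-step true _ = z≤n
  threat-step false {k} {k′} k≤1+k′ = ^-monoʳ-≤ (suc b) (m≤n+o⇒m∸n≤o n k′ (begin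
    n                   ≤⟨ m≤n+m∸n n k ⟩
    k + (n ∸ k)         ≤⟨ +-monoˡ-≤ (n ∸ k) k≤1+k′ ⟩
    suc k′ + (n ∸ k)    ≡⟨ +-suc k′ (n ∸ k) ⟨
    k′ + suc (n ∸ k)    ∎))
    where open ≤-Reasoning

  outside-N[u] : ∀ {u y} → closedNbhd G u y ≡ false → ∀ v → T (closedNbhd G u v) → ¬ v ≡ y
  outside-N[u] y∉N[u] v v∈N[u] refl rewrite y∉N[u] = v∈N[u]

  danger-claim-dom : ∀ β y u → danger (claim dom y β) u + share β y u ≤ danger β u
  danger-claim-dom β y u with closedNbhd G u y in y∈N[u]
  ... | true rewrite threat-dominated (freeIn (claim dom y β) u) (dominated-claim-dom G β (subst T (sym y∈N[u]) _)) =
        ≤-refl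
  ... | false = ≤-reflexive (trans (+-identityʳ _)
                  (danger-cong u λ v v∈N[u] → claim-other dom β (outside-N[u] y∈N[u] v v∈N[u])))

  potential-claim-dom : ∀ β y → potential (claim dom y β) + load β y ≤ potential β
  potential-claim-dom β y =
    ≤-trans (≤-reflexive (sym (∑-+ _ _ (allFin n)))) (∑-mono-≤ (danger-claim-dom β y) (allFin n))

  load-claim-dom : ∀ β y z → load (claim dom y β) z ≤ load β z
  load-claim-dom β y z = ∑-mono-≤ pointwise (allFin n)
    where
    pointwise : ∀ u → share (claim dom y β) z u ≤ share β z u
    pointwise u with closedNbhd G u z
    ... | true = m+n≤o⇒m≤o _ (danger-claim-dom β y u)
    ... | false = z≤n

  freeIn-claim-stal : ∀ β z u → freeIn β u ≤ suc (freeIn (claim stal z β) u)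
  freeIn-claim-stal β z u = ≤-trans (∑-except _≟_ z unchanged (Uniqueₚ.allFin⁺ n)) (+-monoˡ-≤ _ (𝟙≤1 _))
    where
    unchanged : ∀ v → ¬ v ≡ z →
                𝟙 (closedNbhd G u v ∧ isFree (β v)) ≤ 𝟙 (closedNbhd G u v ∧ isFree (claim stal z β v))
    unchanged v v≢z rewrite claim-other stal β v≢z = ≤-refl

  danger-claim-stal : ∀ {β z} → Free β z → ∀ u → danger (claim stal z β) u ≤ danger β u + b * share β z u
  danger-claim-stal {β} {z} z-free u with closedNbhd G u z in z∈N[u]
  ... | true rewrite dominated-cong G {claim stal z β} {β} u λ v _ →
                       claim-preserves isDom β (sym (cong isDom z-free)) v
    = threat-step (dominated G β u) (freeIn-claim-stal β z u)
  ... | false rewrite *-zeroʳ b | +-identityʳ (danger β u) =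
        ≤-reflexive (danger-cong u λ v v∈N[u] → claim-other stal β (outside-N[u] z∈N[u] v v∈N[u]))

  potential-claim-stal : ∀ {β z} → Free β z → potential (claim stal z β) ≤ potential β + b * load β z
  potential-claim-stal {β} {z} z-free = begin
    potential (claim stal z β)                             ≤⟨ ∑-mono-≤ (danger-claim-stal z-free) (allFin n) ⟩
    ∑[ u ∈ allFin n ] (danger β u + b * share β z u)       ≡⟨ ∑-+ _ _ (allFin n) ⟩
    potential β + ∑[ u ∈ allFin n ] (b * share β z u)      ≡⟨ cong (potential β +_) (∑-*ˡ b _ (allFin n)) ⟩
    potential β + b * load β z                             ∎
    where open ≤-Reasoning

  freeVertices : Board n → List (Fin n)
  freeVertices β = filter (λ v → free? (β v)) (allFin n)

  heaviest : Board n → Fin n → Fin n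
  heaviest β v = argmax (load β) v (freeVertices β)

  heaviest-free : ∀ β {v} → Free β v → Free β (heaviest β v)
  heaviest-free β v-free = argmax-all (load β) v-free (Allₚ.all-filter (λ v → free? (β v)) (allFin n))

  heaviest-max : ∀ β v {z} → Free β z → load β z ≤ load β (heaviest β v)
  heaviest-max β v {z} z-free =
    All.lookup (f[xs]≤f[argmax] {f = load β} v (freeVertices β))
               (∈-filter⁺ (λ v → free? (β v)) (∈-allFin z) z-free)

  LoadBound : ℕ → Board n → ℕ → Set
  LoadBound k β I = ∀ z → Free β z → potential β + k * load β z ≤ I

  record GreedyPicks (k : ℕ) (β : Board n) : Set where
    field
      picks      : List (Fin n)
      length≤    : length picks ≤ k
      unique     : Unique picks
      areFree    : All (Free β) picks
      potential≤ : potential (claimAll dom picks β) ≤ potential β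
      outcome    : AllClaimed (claimAll dom picks β) ⊎
                   (length picks ≡ k × LoadBound k (claimAll dom picks β) (potential β))

  greedy : ∀ k β → GreedyPicks k β
  greedy zero β = record
    { picks = [] ; length≤ = z≤n ; unique = [] ; areFree = [] ; potential≤ = ≤-refl
    ; outcome = inj₂ (refl , λ _ _ → ≤-reflexive (+-identityʳ _)) }
  greedy (suc k) β with greedy k β
  ... | g with freeVertex? (claimAll dom (GreedyPicks.picks g) β) | GreedyPicks.outcome g
  ...   | inj₁ done | _ = record
    { picks = picks ; length≤ = m≤n⇒m≤1+n length≤ ; unique = unique ; areFree = areFree
    ; potential≤ = potential≤ ; outcome = inj₁ done }
    where open GreedyPicks g
  ...   | inj₂ (_ , v-free) | inj₁ done = ⊥-elim (done _ v-free)
  ...   | inj₂ (v , v-free) | inj₂ (length≡k , bound) = record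
    { picks = y ∷ picks
    ; length≤ = s≤s length≤
    ; unique = All.tabulate y∉picks ∷ unique
    ; areFree = claimAll-free⁻ picks β y (λ ()) y-free ∷ areFree
    ; potential≤ = ≤-trans (m+n≤o⇒m≤o _ (potential-claim-dom β₁ y)) potential≤
    ; outcome = inj₂ (cong suc length≡k , bound′) }
    where
    open GreedyPicks g
    β₁ = claimAll dom picks β
    y = heaviest β₁ v
    β₂ = claim dom y β₁
    y-free : Free β₁ y
    y-free = heaviest-free β₁ v-free
    y∉picks : ∀ {x} → x ∈ picks → ¬ y ≡ x
    y∉picks x∈picks refl with () ← trans (sym (claimAll-∈ dom β x∈picks)) y-free
    bound′ : LoadBound (suc k) β₂ (potential β)
    bound′ z z-free = begin
      potential β₂ + (load β₂ z + k * load β₂ z)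
        ≤⟨ +-monoʳ-≤ (potential β₂)
             (+-mono-≤ (≤-trans (load-claim-dom β₁ y z) (heaviest-max β₁ v z-free₁)) (*-monoʳ-≤ k (load-claim-dom β₁ y z))) ⟩
      potential β₂ + (load β₁ y + k * load β₁ z)
        ≡⟨ +-assoc (potential β₂) (load β₁ y) _ ⟨
      potential β₂ + load β₁ y + k * load β₁ z
        ≤⟨ +-monoˡ-≤ _ (potential-claim-dom β₁ y) ⟩
      potential β₁ + k * load β₁ z
        ≤⟨ bound z z-free₁ ⟩
      potential β ∎
      where
      open ≤-Reasoning
      z-free₁ : Free β₁ z
      z-free₁ = claim-free⁻ β₁ y z (λ ()) z-free

  greedy-move : 1 ≤ b → ∀ {β v} → Free β v → Σ (DomMove b β) λ m →
                potential (claimAll dom (verts m) β) ≤ potential β ×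
                LoadBound b (claimAll dom (verts m) β) (potential β)
  greedy-move 1≤b {β} {v} v-free = move , potential≤ , bound
    where
    open GreedyPicks (greedy b β)
    nonempty′ : 1 ≤ length picks
    nonempty′ with picks | outcome
    ... | [] | inj₁ done = ⊥-elim (done v v-free)
    ... | [] | inj₂ (0≡b , _) = ≤-trans 1≤b (≤-reflexive (sym 0≡b))
    ... | _ ∷ _ | _ = s≤s z≤n
    move : DomMove b β
    move = record { verts = picks ; nonempty = nonempty′ ; atMost = length≤ ; distinct = unique ; allFree = areFree }
    bound : LoadBound b (claimAll dom picks β) (potential β)
    bound z z-free with outcome
    ... | inj₁ done = ⊥-elim (done z z-free)
    ... | inj₂ (_ , bound′) = bound′ z z-free

  potential-empty : ∀ k → (∀ u → k ≤ closedNbhdSize G u) → potential emptyBoard ≤ n * suc b ^ (n ∸ k)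
  potential-empty k k≤|N[u]| = subst (potential emptyBoard ≤_) (cong (_* suc b ^ (n ∸ k)) (length-allFin n))
                                 (∑-bounded (suc b ^ (n ∸ k)) danger≤ (allFin n))
    where
    danger≤ : ∀ u → danger emptyBoard u ≤ suc b ^ (n ∸ k)
    danger≤ u with dominated G emptyBoard u
    ... | true = z≤n
    ... | false = ^-monoʳ-≤ (suc b) (∸-monoʳ-≤ n (≤-trans (k≤|N[u]| u)
                    (≤-reflexive (∑-cong (λ v → cong 𝟙 (sym (∧-identityʳ _))) (allFin n)))))

  potential-final : ∀ {β} → AllClaimed β → potential β ≡ suc b ^ n * undominated G β
  potential-final {β} done = trans (∑-cong danger-final (allFin n)) (∑-*ˡ (suc b ^ n) _ (allFin n))
    where
    no-free : ∀ u v → ¬ T (closedNbhd G u v ∧ isFree (β v))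
    no-free u v v-free with β v in eq
    ... | free = done v eq
    ... | dom = proj₂ (Equivalence.to T-∧ v-free)
    ... | stal = proj₂ (Equivalence.to T-∧ v-free)
    danger-final : ∀ u → danger β u ≡ suc b ^ n * 𝟙 (not (dominated G β u))
    danger-final u rewrite count-none {p = λ v → closedNbhd G u v ∧ isFree (β v)} (allFin n) (no-free u)
      with dominated G β u
    ... | true = sym (*-zeroʳ (suc b ^ n))
    ... | false = sym (*-identityʳ (suc b ^ n))

^-cancel : ∀ c .{{_ : NonZero c}} {k n U} → k ≤ n → c ^ n * U ≤ n * c ^ (n ∸ k) → U * c ^ k ≤ n
^-cancel c {k} {n} {U} k≤n cⁿU≤ = *-cancelʳ-≤ (U * c ^ k) n (c ^ (n ∸ k)) {{m^n≢0 c (n ∸ k)}} (begin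
  U * c ^ k * c ^ (n ∸ k)   ≡⟨ *-assoc U _ _ ⟩
  U * (c ^ k * c ^ (n ∸ k)) ≡⟨ cong (U *_) (^-distribˡ-+-* c k (n ∸ k)) ⟨
  U * c ^ (k + (n ∸ k))     ≡⟨ cong (λ e → U * c ^ e) (m+[n∸m]≡n k≤n) ⟩
  U * c ^ n                 ≡⟨ *-comm U _ ⟩
  c ^ n * U                 ≤⟨ cⁿU≤ ⟩
  n * c ^ (n ∸ k)           ∎)
  where open ≤-Reasoning

undominated-bound : ∀ {n} (G : Graph n) b → 1 ≤ b → ∀ k → (∀ u → k ≤ closedNbhdSize G u) →
                    DomEnsures G b (λ β → undominated G β * suc b ^ k ≤ n) dominatorTurn emptyBoard
undominated-bound {zero} G b _ k _ = over (λ ()) z≤n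
undominated-bound {suc n} G b 1≤b k k≤|N[u]| = dominatorEnsures move reply ≤-refl
  where
  open ErdősSelfridge G b
  Iᵈ Iˢ : Board (suc n) → Set
  Iᵈ β = potential β ≤ potential emptyBoard
  Iˢ β = Iᵈ β × LoadBound b β (potential emptyBoard)
  k≤n : k ≤ suc n
  k≤n = ≤-trans (k≤|N[u]| fzero)
          (≤-trans (count≤length (closedNbhd G fzero) (allFin (suc n))) (≤-reflexive (length-allFin (suc n))))
  end : ∀ {β} → AllClaimed β → Iᵈ β → undominated G β * suc b ^ k ≤ suc n
  end {β} done Ψ≤ = ^-cancel (suc b) k≤n
    (≤-trans (≤-reflexive (sym (potential-final done))) (≤-trans Ψ≤ (potential-empty k k≤|N[u]|)))
  open Strategy G b _ Iᵈ Iˢ end (λ done → end done ∘ proj₁)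
  move : ∀ {β v} → Iᵈ β → Free β v → Σ (DomMove b β) λ m → Iˢ (claimAll dom (verts m) β)
  move Ψ≤ v-free with greedy-move 1≤b v-free
  ... | m , Ψ′≤Ψ , bound = m , ≤-trans Ψ′≤Ψ Ψ≤ , λ z z-free → ≤-trans (bound z z-free) Ψ≤
  reply : ∀ {β v} → Iˢ β → Free β v → Iᵈ (claim stal v β)
  reply (_ , bound) v-free = ≤-trans (potential-claim-stal v-free) (bound _ v-free)

module _ {n} (G : Graph n) where

  connected⇒neighbour : Connected G → ∀ {u v} → ¬ u ≡ v → Σ (Fin n) (Adj G u)
  connected⇒neighbour connected {u} {v} u≢v with connected u v
  ... | [ _ ] = ⊥-elim (u≢v refl)
  ... | u~w ∷w _ = _ , u~w

  1≤closedNbhdSize : ∀ u → 1 ≤ closedNbhdSize G u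
  1≤closedNbhdSize u = length≤count _≟_ ([] ∷ []) ((∈-allFin u , closedNbhd-self G u) ∷ [])

  2≤closedNbhdSize : ∀ {u w} → Adj G u w → 2 ≤ closedNbhdSize G u
  2≤closedNbhdSize {u} {w} u~w =
    length≤count _≟_ ((u≢w ∷ []) ∷ [] ∷ [])
                 ((∈-allFin u , closedNbhd-self G u) ∷ (∈-allFin w , closedNbhd-adj G u~w) ∷ [])
    where
    u≢w : ¬ u ≡ w
    u≢w refl = subst T (irrefl G u) u~w

another : ∀ {m} → Fin (suc (suc m)) → Fin (suc (suc m))
another fzero = fsuc fzero
another (fsuc _) = fzero

another-≢ : ∀ {m} (u : Fin (suc (suc m))) → ¬ u ≡ another u
another-≢ fzero ()
another-≢ (fsuc _) ()

tree-undominated-bound : ∀ {n} (G : Graph n) b → 1 ≤ b → IsTree G →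
                         DomEnsures G b (λ β → undominated G β * suc b ^ 2 ≤ n) dominatorTurn emptyBoard
tree-undominated-bound {suc zero} G b 1≤b _ =
  DomEnsures-map (λ {β} → single-vertex {undominated G β}) (undominated-bound G b 1≤b 1 (1≤closedNbhdSize G))
  where
  single-vertex : ∀ {U} → U * suc b ^ 1 ≤ 1 → U * suc b ^ 2 ≤ 1
  single-vertex {zero} _ = z≤n
  single-vertex {suc U} c+U*c≤1 =
    ⊥-elim (1+n≰n (≤-trans (s≤s 1≤b) (subst (_≤ 1) (*-identityʳ (suc b)) (m+n≤o⇒m≤o _ c+U*c≤1))))
tree-undominated-bound {suc (suc m)} G b 1≤b (_ , connected , _) =
  undominated-bound G b 1≤b 2 λ u → 2≤closedNbhdSize G (proj₂ (connected⇒neighbour G connected (another-≢ u)))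

dominated-fraction : ∀ {Q n D U} → D + U ≡ n → U * Q ≤ n → (Q ∸ 1) * n ≤ D * Q
dominated-fraction {zero} _ _ = z≤n
dominated-fraction {suc q} {n} {D} {U} D+U≡n U*Q≤n = +-cancelʳ-≤ (U * suc q) (q * n) (D * suc q) (begin
  q * n + U * suc q   ≤⟨ +-monoʳ-≤ (q * n) U*Q≤n ⟩
  q * n + n           ≡⟨ +-comm (q * n) n ⟩
  suc q * n           ≡⟨ cong (suc q *_) D+U≡n ⟨
  suc q * (D + U)     ≡⟨ distrib q D U ⟩
  D * suc q + U * suc q ∎)
  where
  open ≤-Reasoning
  distrib : ∀ q D U → suc q * (D + U) ≡ D * suc q + U * suc q
  distrib = solve-∀

tree-domination : ∀ b → 1 ≤ b → (n : ℕ) (G : Graph n) → IsTree G →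
                  DomEnsures G b (λ β → ((b + 1) ^ 2 ∸ 1) * n ≤ domCount G β * (b + 1) ^ 2) dominatorTurn emptyBoard
tree-domination b 1≤b n G tree = DomEnsures-map fraction (tree-undominated-bound G b 1≤b tree)
  where
  fraction : ∀ {β} → undominated G β * suc b ^ 2 ≤ n → ((b + 1) ^ 2 ∸ 1) * n ≤ domCount G β * (b + 1) ^ 2
  fraction {β} bound = dominated-fraction {(b + 1) ^ 2} {n} {domCount G β} {undominated G β} (domCount+undominated G β)
                         (subst (λ Q → undominated G β * Q ≤ n) (cong (_^ 2) (+-comm 1 b)) bound)

-- Trees given by parent pointers; the star of stars

module RootedForest {n : ℕ} (G : Graph n) (parent : Fin n → Fin n) (depth : Fin n → ℕ) where

  ChildOf : Fin n → Fin n → Set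
  ChildOf u v = parent u ≡ v × depth u ≡ suc (depth v)

  module _ (edge : ∀ u v → Adj G u v → ChildOf u v ⊎ ChildOf v u) where

    _++[_] : List (Fin n) → Fin n → List (Fin n)
    ms ++[ z ] = foldr List._∷_ (z ∷ []) ms

    path : Fin n → List (Fin n) → Fin n → List (Fin n)
    path a ms z = a ∷ ms ++[ z ]

    second : List (Fin n) → Fin n → Fin n
    second [] z = z
    second (m ∷ _) z = m

    penultimate : Fin n → List (Fin n) → Fin n
    penultimate a [] = a
    penultimate a (m ∷ ms) = penultimate m ms

    last∈ : ∀ ms z → z ∈ ms ++[ z ]
    last∈ [] z = here refl
    last∈ (m ∷ ms) z = there (last∈ ms z)

    second∈ : ∀ ms z → second ms z ∈ ms ++[ z ]
    second∈ [] z = here refl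
    second∈ (m ∷ ms) z = here refl

    penultimate∈ : ∀ m ms z → penultimate m ms ∈ m ∷ ms ++[ z ]
    penultimate∈ m [] z = here refl
    penultimate∈ m (m′ ∷ ms) z = there (penultimate∈ m′ ms z)

    first-edge : ∀ a ms z → Chain G (path a ms z) → Adj G a (second ms z)
    first-edge a [] z (cons a~z _) = a~z
    first-edge a (_ ∷ _) z (cons a~m _) = a~m

    -- Once a repetition-free path steps down to a child, it can never step up again.
    descending : ∀ a ms z → Chain G (path a ms z) → Unique (path a ms z) → ChildOf (second ms z) a →
                 depth z ≡ depth a + suc (length ms)
    descending a [] z _ _ (_ , z-below-a) = trans z-below-a (+-comm 1 (depth a))
    descending a (m ∷ ms) z (cons _ steps) (a∉ ∷ rest!) (m-parent , m-below-a)
      with edge m (second ms z) (first-edge m ms z steps)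
    ... | inj₁ (m-up , _) = ⊥-elim (All.lookup a∉ (there (second∈ ms z)) (trans (sym m-parent) m-up))
    ... | inj₂ down = trans (descending m ms z steps rest! down)
                            (trans (cong (_+ suc (length ms)) m-below-a) (sym (+-suc (depth a) _)))

    ends-lower-or-below : ∀ a ms z → Chain G (path a ms z) → Unique (path a ms z) →
                          depth z < depth a ⊎ parent z ≡ penultimate a ms
    ends-lower-or-below a [] z (cons a~z _) _ with edge a z a~z
    ... | inj₁ (_ , a-below-z) = inj₁ (≤-reflexive (sym a-below-z))
    ... | inj₂ (z-parent , _) = inj₂ z-parent
    ends-lower-or-below a (m ∷ ms) z (cons a~m steps) (a∉ ∷ rest!) with ends-lower-or-below m ms z steps rest!
    ... | inj₂ z-parent = inj₂ z-parent
    ... | inj₁ z<m with edge a m a~m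
    ...   | inj₁ (_ , a-below-m) = inj₁ (≤-trans z<m (≤-trans (n≤1+n _) (≤-reflexive (sym a-below-m))))
    ...   | inj₂ down@(_ , m-below-a) = ⊥-elim (<⇒≱ z<m (begin
            depth m                       ≡⟨ m-below-a ⟩
            suc (depth a)                 ≤⟨ s≤s (m≤m+n (depth a) (suc (length ms))) ⟩
            suc (depth a + suc (length ms)) ≡⟨ +-suc (depth a) _ ⟨
            depth a + suc (suc (length ms)) ≡⟨ descending a (m ∷ ms) z (cons a~m steps) (a∉ ∷ rest!) down ⟨
            depth z                       ∎))
      where open ≤-Reasoning

    acyclic : Acyclic G
    acyclic record { middle = [] ; long = () }
    acyclic record { first = a ; middle = m ∷ ms ; last = z ; unique = uniq@(a∉ ∷ m∉ ∷ _)
                   ; chain = steps@(cons a~m _) ; closes = z~a }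
      with edge a m a~m | edge z a z~a
    ... | inj₂ down | inj₁ (_ , z-below-a) = ⊥-elim (1+n≰n (begin
          suc (suc (depth a))                ≡⟨ +-comm 2 (depth a) ⟩
          depth a + 2                        ≤⟨ +-monoʳ-≤ (depth a) (s≤s (s≤s z≤n)) ⟩
          depth a + suc (suc (length ms))    ≡⟨ descending a (m ∷ ms) z steps uniq down ⟨
          depth z                            ≡⟨ z-below-a ⟩
          suc (depth a)                      ∎))
      where open ≤-Reasoning
    ... | inj₂ down | inj₂ (_ , a-below-z) = ⊥-elim (1+n≰n (begin
          suc (depth z)                      ≡⟨ a-below-z ⟨
          depth a                            ≤⟨ m≤m+n (depth a) _ ⟩
          depth a + suc (suc (length ms))    ≡⟨ descending a (m ∷ ms) z steps uniq down ⟨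
          depth z                            ∎))
      where open ≤-Reasoning
    ... | inj₁ (a-parent , _) | inj₂ (a-parent′ , _) =
          ⊥-elim (All.lookup m∉ (subst (_∈ ms ++[ z ]) (trans (sym a-parent′) a-parent) (last∈ ms z)) refl)
    ... | inj₁ _ | inj₁ (z-parent , z-below-a) with ends-lower-or-below a (m ∷ ms) z steps uniq
    ...   | inj₁ z<a = ⊥-elim (<⇒≱ z<a (≤-trans (n≤1+n _) (≤-reflexive (sym z-below-a))))
    ...   | inj₂ z-parent′ = ⊥-elim (All.lookup a∉ (penultimate∈ m ms z) (trans (sym z-parent) z-parent′))

data Kind (k L : ℕ) : Set where
  hub    : Kind k L
  centre : Fin k → Kind k L
  leaf   : Fin k → Fin L → Kind k L

isLeafKind isCentreKind : ∀ {k L} → Kind k L → Bool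
isLeafKind (leaf _ _) = true
isLeafKind _ = false
isCentreKind (centre _) = true
isCentreKind _ = false

module StarOfStars (k L : ℕ) where

  N : ℕ
  N = suc (k * suc L)

  k≤N : k ≤ N
  k≤N = ≤-trans (m≤m*n k (suc L)) (n≤1+n _)

  star : Fin k × Fin (suc L) → Kind k L
  star (c , fzero) = centre c
  star (c , fsuc j) = leaf c j

  kind : Fin N → Kind k L
  kind fzero = hub
  kind (fsuc v) = star (remQuot (suc L) v)

  vertex : Kind k L → Fin N
  vertex hub = fzero
  vertex (centre c) = fsuc (combine c fzero)
  vertex (leaf c j) = fsuc (combine c (fsuc j))

  kind-vertex : ∀ κ → kind (vertex κ) ≡ κ
  kind-vertex hub = refl
  kind-vertex (centre c) rewrite remQuot-combine {k} {suc L} c fzero = refl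
  kind-vertex (leaf c j) rewrite remQuot-combine {k} {suc L} c (fsuc j) = refl

  vertex-star : ∀ p → vertex (star p) ≡ fsuc (uncurry combine p)
  vertex-star (c , fzero) = refl
  vertex-star (c , fsuc j) = refl

  vertex-kind : ∀ v → vertex (kind v) ≡ v
  vertex-kind fzero = refl
  vertex-kind (fsuc v) = trans (vertex-star (remQuot (suc L) v)) (cong fsuc (combine-remQuot {k} (suc L) v))

  kind-injective : ∀ {u v} → kind u ≡ kind v → u ≡ v
  kind-injective {u} {v} eq = trans (sym (vertex-kind u)) (trans (cong vertex eq) (vertex-kind v))

  adjKind : Kind k L → Kind k L → Bool
  adjKind hub (centre _) = true
  adjKind (centre _) hub = true
  adjKind (centre c) (leaf c′ _) = ⌊ c ≟ c′ ⌋
  adjKind (leaf c′ _) (centre c) = ⌊ c ≟ c′ ⌋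
  adjKind _ _ = false

  adjKind-sym : ∀ κ κ′ → adjKind κ κ′ ≡ adjKind κ′ κ
  adjKind-sym hub hub = refl
  adjKind-sym hub (centre _) = refl
  adjKind-sym hub (leaf _ _) = refl
  adjKind-sym (centre _) hub = refl
  adjKind-sym (centre _) (centre _) = refl
  adjKind-sym (centre _) (leaf _ _) = refl
  adjKind-sym (leaf _ _) hub = refl
  adjKind-sym (leaf _ _) (centre _) = refl
  adjKind-sym (leaf _ _) (leaf _ _) = refl

  adjKind-irrefl : ∀ κ → adjKind κ κ ≡ false
  adjKind-irrefl hub = refl
  adjKind-irrefl (centre _) = refl
  adjKind-irrefl (leaf _ _) = refl

  starOfStars : Graph N
  starOfStars = record
    { adj = λ u v → adjKind (kind u) (kind v)
    ; sym = λ u v → adjKind-sym (kind u) (kind v)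
    ; irrefl = λ v → adjKind-irrefl (kind v) }

  parentKind : Kind k L → Kind k L
  parentKind (leaf c _) = centre c
  parentKind _ = hub

  depthKind : Kind k L → ℕ
  depthKind hub = 0
  depthKind (centre _) = 1
  depthKind (leaf _ _) = 2

  parent : Fin N → Fin N
  parent v = vertex (parentKind (kind v))

  depth : Fin N → ℕ
  depth v = depthKind (kind v)

  kind-parent : ∀ v → kind (parent v) ≡ parentKind (kind v)
  kind-parent v = kind-vertex (parentKind (kind v))

  open RootedForest starOfStars parent depth using (ChildOf; acyclic)

  edgeKind : ∀ κ κ′ → T (adjKind κ κ′) →
             (parentKind κ ≡ κ′ × depthKind κ ≡ suc (depthKind κ′)) ⊎
             (parentKind κ′ ≡ κ × depthKind κ′ ≡ suc (depthKind κ))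
  edgeKind hub (centre _) _ = inj₂ (refl , refl)
  edgeKind (centre _) hub _ = inj₁ (refl , refl)
  edgeKind (centre c) (leaf c′ _) c≡c′ rewrite toWitness c≡c′ = inj₂ (refl , refl)
  edgeKind (leaf c′ _) (centre c) c≡c′ rewrite toWitness c≡c′ = inj₁ (refl , refl)

  edge : ∀ u v → Adj starOfStars u v → ChildOf u v ⊎ ChildOf v u
  edge u v u~v with edgeKind (kind u) (kind v) u~v
  ... | inj₁ (up , deeper) = inj₁ (kind-injective (trans (kind-parent u) up) , deeper)
  ... | inj₂ (down , deeper) = inj₂ (kind-injective (trans (kind-parent v) down) , deeper)

  _++ʷ_ : ∀ {u v w} → Walk starOfStars u v → Walk starOfStars v w → Walk starOfStars u w
  [ _ ] ++ʷ q = q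
  (u~x ∷w p) ++ʷ q = u~x ∷w (p ++ʷ q)

  step : ∀ κ κ′ → T (adjKind κ κ′) → Walk starOfStars (vertex κ) (vertex κ′)
  step κ κ′ κ~κ′ = subst T (sym (cong₂ adjKind (kind-vertex κ) (kind-vertex κ′))) κ~κ′ ∷w [ vertex κ′ ]

  toHub : ∀ κ → Walk starOfStars (vertex κ) (vertex hub)
  toHub hub = [ vertex hub ]
  toHub (centre c) = step (centre c) hub _
  toHub (leaf c j) = step (leaf c j) (centre c) (fromWitness refl) ++ʷ toHub (centre c)

  fromHub : ∀ κ → Walk starOfStars (vertex hub) (vertex κ)
  fromHub hub = [ vertex hub ]
  fromHub (centre c) = step hub (centre c) _
  fromHub (leaf c j) = fromHub (centre c) ++ʷ step (centre c) (leaf c j) (fromWitness refl)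

  connected : Connected starOfStars
  connected u v = subst₂ (Walk starOfStars) (vertex-kind u) (vertex-kind v) (toHub (kind u) ++ʷ fromHub (kind v))

  isTree : IsTree starOfStars
  isTree = s≤s z≤n , connected , acyclic edge

  isLeaf isCentre : Fin N → Bool
  isLeaf v = isLeafKind (kind v)
  isCentre v = isCentreKind (kind v)

  leaf-parent : ∀ v → T (isLeaf v) → T (isCentre (parent v))
  leaf-parent v v-leaf = subst (T ∘ isCentreKind) (sym (kind-parent v)) (leafKind-parent (kind v) v-leaf)
    where
    leafKind-parent : ∀ κ → T (isLeafKind κ) → T (isCentreKind (parentKind κ))
    leafKind-parent (leaf _ _) _ = _

  centre-not-leaf : ∀ v → T (isCentre v) → ¬ T (isLeaf v)
  centre-not-leaf v with kind v
  ... | centre _ = λ _ ()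

  leaf-parent-≢ : ∀ v → T (isLeaf v) → ¬ parent v ≡ v
  leaf-parent-≢ v v-leaf v-parent = centre-not-leaf v (subst (T ∘ isCentre) v-parent (leaf-parent v v-leaf)) v-leaf

  leaf-neighbour : ∀ {v u} → T (isLeaf v) → Adj starOfStars v u → u ≡ parent v
  leaf-neighbour {v} {u} v-leaf v~u =
    kind-injective (trans (leafKind-adj (kind v) (kind u) v-leaf v~u) (sym (kind-parent v)))
    where
    leafKind-adj : ∀ κ κ′ → T (isLeafKind κ) → T (adjKind κ κ′) → κ′ ≡ parentKind κ
    leafKind-adj (leaf c _) (centre c′) _ c′≡c rewrite toWitness c′≡c = refl

  vertex-injective : ∀ {κ κ′} → vertex κ ≡ vertex κ′ → κ ≡ κ′
  vertex-injective {κ} {κ′} eq = trans (sym (kind-vertex κ)) (trans (cong kind eq) (kind-vertex κ′))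

  #_ : (Fin N → Bool) → ℕ
  # p = count p (allFin N)

  #-claim : ∀ {p p′ : Fin N → Bool} y → (∀ x → ¬ x ≡ y → T (p′ x) → T (p x)) → # p′ ≤ 𝟙 (p′ y) + # p
  #-claim y p′⇒p = ∑-except _≟_ y (λ x x≢y → 𝟙-mono (p′⇒p x x≢y)) (Uniqueₚ.allFin⁺ N)

  #-cong : ∀ {p q : Fin N → Bool} → (∀ v → p v ≡ q v) → # p ≡ # q
  #-cong p≗q = ∑-cong (λ v → cong 𝟙 (p≗q v)) (allFin N)

  k≤#centres : k ≤ # isCentre
  k≤#centres = injection⇒≤count isCentre (vertex ∘ centre) centre-injective
                 (λ c → subst (T ∘ isCentreKind) (sym (kind-vertex (centre c))) _)
    where
    centre-injective : ∀ {c c′} → vertex (centre c) ≡ vertex (centre c′) → c ≡ c′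
    centre-injective {c} {c′} eq with vertex-injective {centre c} {centre c′} eq
    ... | refl = refl

  L≤#leavesOf : ∀ z → T (isCentre z) → L ≤ # (λ x → isLeaf x ∧ ⌊ parent x ≟ z ⌋)
  L≤#leavesOf z z-centre with kind z in z-kind
  ... | centre c =
    injection⇒≤count (λ x → isLeaf x ∧ ⌊ parent x ≟ z ⌋) (vertex ∘ leaf c) leaf-injective leaf-of-z
    where
    leaf-injective : ∀ {j j′} → vertex (leaf c j) ≡ vertex (leaf c j′) → j ≡ j′
    leaf-injective {j} {j′} eq with vertex-injective {leaf c j} {leaf c j′} eq
    ... | refl = refl
    leaf-of-z : ∀ j → T (isLeaf (vertex (leaf c j)) ∧ ⌊ parent (vertex (leaf c j)) ≟ z ⌋)
    leaf-of-z j rewrite kind-vertex (leaf c j) = fromWitness (trans (cong vertex (sym z-kind)) (vertex-kind z))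

-- Staller's strategy on the star of stars

module StallerOnStarOfStars (k L b : ℕ) where

  open StarOfStars k L

  stalCentre domCentre stalLeaf domLeaf underStal : Board N → Fin N → Bool
  stalCentre β v = isCentre v ∧ isStal (β v)
  domCentre β v = isCentre v ∧ isDom (β v)
  stalLeaf β v = isLeaf v ∧ isStal (β v) ∧ isStal (β (parent v))
  domLeaf β v = isLeaf v ∧ isDom (β v) ∧ not (isDom (β (parent v)))
  underStal β v = isLeaf v ∧ isStal (β (parent v))

  CentreOpen LeafOpen Open : Board N → Set
  CentreOpen β = ∃ λ v → T (isCentre v) × Free β v
  LeafOpen β = ∃ λ v → T (isLeaf v) × Free β v × T (isStal (β (parent v)))
  Open β = CentreOpen β ⊎ LeafOpen β

  centreOpen? : ∀ β → Dec (CentreOpen β)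
  centreOpen? β = any? λ v → T? (isCentre v) ×-dec free? (β v)

  leafOpen? : ∀ β → Dec (LeafOpen β)
  leafOpen? β = any? λ v → T? (isLeaf v) ×-dec free? (β v) ×-dec T? (isStal (β (parent v)))

  centreOpen⁻ : ∀ {c β y} → ¬ c ≡ free → CentreOpen (claim c y β) → CentreOpen β
  centreOpen⁻ {β = β} {y} c≢free (v , v-centre , v-free) = v , v-centre , claim-free⁻ β y v c≢free v-free

  open⁻ : ∀ {c β y} → ¬ c ≡ free → Free β y → Open (claim c y β) → Open β
  open⁻ c≢free _ (inj₁ centre-open) = inj₁ (centreOpen⁻ c≢free centre-open)
  open⁻ {c} {β} {y} c≢free y-free (inj₂ (v , v-leaf , v-free , parent-stal)) with parent v ≟ y
  ... | yes refl = inj₁ (parent v , leaf-parent v v-leaf , y-free)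
  ... | no _ = inj₂ (v , v-leaf , claim-free⁻ β y v c≢free v-free , parent-stal)

  parent-dom : ∀ {β y} → ¬ Open β → Free β y → T (isLeaf y) → β (parent y) ≡ dom
  parent-dom {β} {y} frozen y-free y-leaf with β (parent y) in eq
  ... | free = ⊥-elim (frozen (inj₁ (parent y , leaf-parent y y-leaf , eq)))
  ... | dom = refl
  ... | stal = ⊥-elim (frozen (inj₂ (y , y-leaf , y-free , subst (T ∘ isStal) (sym eq) _)))

  domCentres-claim-dom : ∀ β y → # domCentre (claim dom y β) ≤ 𝟙 (isCentre y) + # domCentre β
  domCentres-claim-dom β y =
    ≤-trans (#-claim y unchanged) (+-monoˡ-≤ _ (𝟙-mono {domCentre (claim dom y β) y} (∧-proj₁ {isCentre y})))
    where
    unchanged : ∀ x → ¬ x ≡ y → T (domCentre (claim dom y β) x) → T (domCentre β x)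
    unchanged x x≢y = subst (λ c → T (isCentre x ∧ isDom c)) (claim-other dom β x≢y)

  domLeaves-claim-dom : ∀ β y →
                        # domLeaf (claim dom y β) ≤ 𝟙 (isLeaf y ∧ not (isDom (β (parent y)))) + # domLeaf β
  domLeaves-claim-dom β y = ≤-trans (#-claim y unchanged) (+-monoˡ-≤ _ (𝟙-mono {domLeaf (claim dom y β) y} at-y))
    where
    unchanged : ∀ x → ¬ x ≡ y → T (domLeaf (claim dom y β) x) → T (domLeaf β x)
    unchanged x x≢y = ∧-mono-T {isLeaf x} id
      (∧-mono-T {isDom (claim dom y β x)} (subst (T ∘ isDom) (claim-other dom β x≢y))
                                          (not-anti-T (claim-mono isDom β _ (parent x))))
    at-y : T (domLeaf (claim dom y β) y) → T (isLeaf y ∧ not (isDom (β (parent y))))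
    at-y y-domLeaf = Equivalence.from T-∧ (y-leaf ,
      subst (T ∘ not ∘ isDom) (claim-other dom β (leaf-parent-≢ y y-leaf))
            (∧-proj₂ {isDom (claim dom y β y)} (∧-proj₂ {isLeaf y} y-domLeaf)))
      where
      y-leaf = ∧-proj₁ {isLeaf y} y-domLeaf

  module _ {β : Board N} {y} (y-free : Free β y) where

    domCentres-step : # domCentre (claim dom y β) ≤ suc (# domCentre β)
    domCentres-step = ≤-trans (domCentres-claim-dom β y) (+-monoˡ-≤ _ (𝟙≤1 _))

    domCentres-frozen : ¬ CentreOpen β →
                        # domCentre (claim dom y β) ≤ # domCentre β × ¬ CentreOpen (claim dom y β)
    domCentres-frozen frozen =
      ≤-trans (domCentres-claim-dom β y)
              (≤-reflexive (cong (_+ _) (𝟙-false λ y-centre → frozen (y , y-centre , y-free)))) ,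
      frozen ∘ centreOpen⁻ (λ ())

    domLeaves-step : # domLeaf (claim dom y β) ≤ suc (# domLeaf β)
    domLeaves-step = ≤-trans (domLeaves-claim-dom β y) (+-monoˡ-≤ _ (𝟙≤1 _))

    domLeaves-frozen : ¬ Open β → # domLeaf (claim dom y β) ≤ # domLeaf β × ¬ Open (claim dom y β)
    domLeaves-frozen frozen =
      ≤-trans (domLeaves-claim-dom β y) (≤-reflexive (cong (_+ _) (𝟙-false no-increment))) ,
      frozen ∘ open⁻ (λ ()) y-free
      where
      no-increment : ¬ T (isLeaf y ∧ not (isDom (β (parent y))))
      no-increment y-leaf∧¬dom =
        subst (T ∘ not ∘ isDom) (parent-dom frozen y-free (∧-proj₁ y-leaf∧¬dom)) (∧-proj₂ y-leaf∧¬dom)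

  -- Staller's claims pay for Dominator's: each Staller centre makes room for b Dominator centres, and each
  -- Staller centre or Staller leaf under a Staller centre for b leaves in domLeaf.  The right disjuncts of Iᵈ
  -- record the positions where Dominator can no longer add to the count, so that she needs no prepayment.
  Iˢ Iᵈ : Board N → Set
  Iˢ β = # domLeaf β ≤ b * (# stalLeaf β + # stalCentre β) + b
       × # domCentre β ≤ b * # stalCentre β + b
       × # stalCentre β * L ≤ # underStal β
  Iᵈ β = Iˢ β × (# domCentre β ≤ b * # stalCentre β ⊎ ¬ CentreOpen β)
              × (# domLeaf β ≤ b * (# stalLeaf β + # stalCentre β) ⊎ ¬ Open β)

  dominator-move : ∀ {β} → Iᵈ β → (m : DomMove b β) → Iˢ (claimAll dom (verts m) β)
  dominator-move {β} ((domLeaves≤ , domCentres≤ , stalCentres≤) , centres≤ , leaves≤) m =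
    domLeaves≤′ , domCentres≤′ , stalCentres≤′
    where
    ys = verts m
    β′ = claimAll dom ys β
    stal-same : ∀ v → isStal (β′ v) ≡ isStal (β v)
    stal-same = claimAll-preserves isStal ys β refl (allFree m)
    stalCentres≡ : # stalCentre β′ ≡ # stalCentre β
    stalCentres≡ = #-cong λ v → cong (isCentre v ∧_) (stal-same v)
    stalLeaves≡ : # stalLeaf β′ ≡ # stalLeaf β
    stalLeaves≡ = #-cong λ v → cong (isLeaf v ∧_) (cong₂ _∧_ (stal-same v) (stal-same (parent v)))
    underStal≡ : # underStal β′ ≡ # underStal β
    underStal≡ = #-cong λ v → cong (isLeaf v ∧_) (stal-same (parent v))
    domLeaves≤′ : # domLeaf β′ ≤ b * (# stalLeaf β′ + # stalCentre β′) + b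
    domLeaves≤′ rewrite stalLeaves≡ | stalCentres≡ =
      domMove-bound (#_ ∘ domLeaf) (¬_ ∘ Open) domLeaves-step domLeaves-frozen m leaves≤ domLeaves≤
    domCentres≤′ : # domCentre β′ ≤ b * # stalCentre β′ + b
    domCentres≤′ rewrite stalCentres≡ =
      domMove-bound (#_ ∘ domCentre) (¬_ ∘ CentreOpen) domCentres-step domCentres-frozen m centres≤ domCentres≤
    stalCentres≤′ : # stalCentre β′ * L ≤ # underStal β′
    stalCentres≤′ rewrite stalCentres≡ | underStal≡ = stalCentres≤

  absorb : ∀ {x y} → suc x ≤ y → b * x + b ≤ b * y
  absorb {x} suc-x≤y = ≤-trans (≤-reflexive (trans (+-comm _ b) (sym (*-suc b x)))) (*-monoʳ-≤ b suc-x≤y)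

  module StallerClaim (β : Board N) (z : Fin N) (z-free : Free β z) where

    β′ : Board N
    β′ = claim stal z β

    dom-same : ∀ v → isDom (β′ v) ≡ isDom (β v)
    dom-same = claim-preserves isDom β (sym (cong isDom z-free))

    stal-mono : ∀ v → T (isStal (β v)) → T (isStal (β′ v))
    stal-mono = claim-mono isStal β _

    domLeaves≡ : # domLeaf β′ ≡ # domLeaf β
    domLeaves≡ = #-cong λ v → cong (isLeaf v ∧_) (cong₂ (λ d p → d ∧ not p) (dom-same v) (dom-same (parent v)))

    domCentres≡ : # domCentre β′ ≡ # domCentre β
    domCentres≡ = #-cong λ v → cong (isCentre v ∧_) (dom-same v)

    stalCentres≡ : # stalCentre β′ ≡ 𝟙 (isCentre z) + # stalCentre β
    stalCentres≡ = trans (count-update _≟_ z unchanged not-yet (Uniqueₚ.allFin⁺ N) (∈-allFin z))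
                         (cong (λ c → 𝟙 c + # stalCentre β) now)
      where
      unchanged : ∀ x → ¬ x ≡ z → stalCentre β′ x ≡ stalCentre β x
      unchanged x x≢z = cong (λ c → isCentre x ∧ isStal c) (claim-other stal β x≢z)
      not-yet : ¬ T (stalCentre β z)
      not-yet z-stal = subst (T ∘ isStal) z-free (∧-proj₂ {isCentre z} z-stal)
      now : stalCentre β′ z ≡ isCentre z
      now rewrite claim-same stal z β = ∧-identityʳ (isCentre z)

    stalCentres≤ : # stalCentre β ≤ # stalCentre β′
    stalCentres≤ = subst (_ ≤_) (sym stalCentres≡) (m≤n+m _ _)

    stalLeaves-mono : ∀ v → 𝟙 (stalLeaf β v) ≤ 𝟙 (stalLeaf β′ v)
    stalLeaves-mono v = 𝟙-mono {stalLeaf β v}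
      (∧-mono-T {isLeaf v} id (∧-mono-T {isStal (β v)} (stal-mono v) (stal-mono (parent v))))

    stalLeaves≤ : # stalLeaf β ≤ # stalLeaf β′
    stalLeaves≤ = ∑-mono-≤ stalLeaves-mono (allFin N)

    stalLeaves< : T (isLeaf z) → T (isStal (β (parent z))) → suc (# stalLeaf β) ≤ # stalLeaf β′
    stalLeaves< z-leaf parent-stal = ∑-gain stalLeaves-mono at-z (∈-allFin z)
      where
      gain : ∀ {a c} → T a → T c → 1 + 𝟙 (a ∧ false) ≤ 𝟙 (a ∧ true ∧ c)
      gain {true} {true} _ _ = ≤-refl
      at-z : 1 + 𝟙 (stalLeaf β z) ≤ 𝟙 (stalLeaf β′ z)
      at-z rewrite claim-same stal z β | claim-other stal β (leaf-parent-≢ z z-leaf) | z-free = gain z-leaf parent-stal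

    underStal-mono : ∀ v → 𝟙 (underStal β v) ≤ 𝟙 (underStal β′ v)
    underStal-mono v = 𝟙-mono {underStal β v} (∧-mono-T {isLeaf v} id (stal-mono (parent v)))

    underStal≤ : 𝟙 (isCentre z) * L + # underStal β ≤ # underStal β′
    underStal≤ with isCentre z in z-centre
    ... | false = ∑-mono-≤ underStal-mono (allFin N)
    ... | true = begin
      1 * L + # underStal β                      ≡⟨ cong (_+ # underStal β) (*-identityˡ L) ⟩
      L + # underStal β                          ≤⟨ +-monoˡ-≤ _ (L≤#leavesOf z (subst T (sym z-centre) _)) ⟩
      # leafOf-z + # underStal β                 ≡⟨ ∑-+ (𝟙 ∘ leafOf-z) (𝟙 ∘ underStal β) (allFin N) ⟨
      ∑[ x ∈ allFin N ] (𝟙 (leafOf-z x) + 𝟙 (underStal β x)) ≤⟨ ∑-mono-≤ pointwise (allFin N) ⟩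
      # underStal β′                             ∎
      where
      open ≤-Reasoning
      leafOf-z : Fin N → Bool
      leafOf-z x = isLeaf x ∧ ⌊ parent x ≟ z ⌋
      child : ∀ a → 𝟙 (a ∧ true) + 𝟙 (a ∧ false) ≤ 𝟙 (a ∧ true)
      child true = ≤-refl
      child false = ≤-refl
      non-child : ∀ a c → 𝟙 (a ∧ false) + 𝟙 (a ∧ c) ≤ 𝟙 (a ∧ c)
      non-child true c = ≤-refl
      non-child false c = ≤-refl
      pointwise : ∀ x → 𝟙 (leafOf-z x) + 𝟙 (underStal β x) ≤ 𝟙 (underStal β′ x)
      pointwise x with parent x ≟ z
      ... | yes refl rewrite z-free = child (isLeaf x)
      ... | no _ = non-child (isLeaf x) _

    Iˢ-preserved : Iˢ β → Iˢ β′
    Iˢ-preserved (domLeaves≤ , domCentres≤ , stalCentres*L≤) =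
      domLeaves≤′ , domCentres≤′ , stalCentres*L≤′
      where
      domLeaves≤′ : # domLeaf β′ ≤ b * (# stalLeaf β′ + # stalCentre β′) + b
      domLeaves≤′ rewrite domLeaves≡ =
        ≤-trans domLeaves≤ (+-monoˡ-≤ b (*-monoʳ-≤ b (+-mono-≤ stalLeaves≤ stalCentres≤)))
      domCentres≤′ : # domCentre β′ ≤ b * # stalCentre β′ + b
      domCentres≤′ rewrite domCentres≡ = ≤-trans domCentres≤ (+-monoˡ-≤ b (*-monoʳ-≤ b stalCentres≤))
      stalCentres*L≤′ : # stalCentre β′ * L ≤ # underStal β′
      stalCentres*L≤′ rewrite stalCentres≡ = begin
        (𝟙 (isCentre z) + # stalCentre β) * L      ≡⟨ *-distribʳ-+ L (𝟙 (isCentre z)) _ ⟩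
        𝟙 (isCentre z) * L + # stalCentre β * L    ≤⟨ +-monoʳ-≤ _ stalCentres*L≤ ⟩
        𝟙 (isCentre z) * L + # underStal β         ≤⟨ underStal≤ ⟩
        # underStal β′                             ∎
        where open ≤-Reasoning

  staller-move : ∀ {β v} → Iˢ β → Free β v → Σ (Fin N) λ z → Free β z × Iᵈ (claim stal z β)
  staller-move {β} {v} i@(domLeaves≤ , domCentres≤ , _) v-free with centreOpen? β
  ... | yes (z , z-centre , z-free) = z , z-free , Iˢ-preserved i , inj₁ domCentres≤′ , inj₁ domLeaves≤′
    where
    open StallerClaim β z z-free
    one-more : suc (# stalCentre β) ≤ # stalCentre β′
    one-more = ≤-reflexive (sym (trans stalCentres≡ (cong (_+ _) (𝟙-true z-centre))))
    domCentres≤′ : # domCentre β′ ≤ b * # stalCentre β′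
    domCentres≤′ rewrite domCentres≡ = ≤-trans domCentres≤ (absorb one-more)
    domLeaves≤′ : # domLeaf β′ ≤ b * (# stalLeaf β′ + # stalCentre β′)
    domLeaves≤′ rewrite domLeaves≡ =
      ≤-trans domLeaves≤
              (absorb (subst (_≤ # stalLeaf β′ + # stalCentre β′) (+-suc _ _) (+-mono-≤ stalLeaves≤ one-more)))
  ... | no ¬centreOpen with leafOpen? β
  ...   | yes (z , z-leaf , z-free , parent-stal) =
          z , z-free , Iˢ-preserved i , inj₂ (¬centreOpen ∘ centreOpen⁻ (λ ())) , inj₁ domLeaves≤′
    where
    open StallerClaim β z z-free
    domLeaves≤′ : # domLeaf β′ ≤ b * (# stalLeaf β′ + # stalCentre β′)
    domLeaves≤′ rewrite domLeaves≡ =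
      ≤-trans domLeaves≤ (absorb (+-mono-≤ (stalLeaves< z-leaf parent-stal) stalCentres≤))
  ...   | no ¬leafOpen =
          v , v-free , StallerClaim.Iˢ-preserved β v v-free i , inj₂ (¬centreOpen ∘ centreOpen⁻ (λ ())) ,
          inj₂ ([ ¬centreOpen , ¬leafOpen ]′ ∘ open⁻ (λ ()) v-free)

  StallerOutcome : Board N → Set
  StallerOutcome β = Σ ℕ λ s → s * L ≤ suc b * undominated starOfStars β + b * s + b × k ≤ suc b * s + b

  module _ {β : Board N} (done : AllClaimed β) where

    underStal-final : # underStal β ≤ # domLeaf β + # stalLeaf β
    underStal-final = ≤-trans (∑-mono-≤ (λ x → final-cell (isLeaf x) (done x)) (allFin N))
                              (≤-reflexive (∑-+ (𝟙 ∘ domLeaf β) (𝟙 ∘ stalLeaf β) (allFin N)))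
      where
      final-cell : ∀ l {a p} → ¬ a ≡ free →
                   𝟙 (l ∧ isStal p) ≤ 𝟙 (l ∧ isDom a ∧ not (isDom p)) + 𝟙 (l ∧ isStal a ∧ isStal p)
      final-cell false _ = z≤n
      final-cell true {free} a≢free = ⊥-elim (a≢free refl)
      final-cell true {dom} {free} _ = z≤n
      final-cell true {dom} {dom} _ = z≤n
      final-cell true {dom} {stal} _ = ≤-refl
      final-cell true {stal} {free} _ = z≤n
      final-cell true {stal} {dom} _ = z≤n
      final-cell true {stal} {stal} _ = ≤-refl

    centres-final : k ≤ # domCentre β + # stalCentre β
    centres-final = ≤-trans k≤#centres (≤-trans (∑-mono-≤ (λ x → final-cell (isCentre x) (done x)) (allFin N))
                                                (≤-reflexive (∑-+ (𝟙 ∘ domCentre β) (𝟙 ∘ stalCentre β) (allFin N))))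
      where
      final-cell : ∀ c {a} → ¬ a ≡ free → 𝟙 c ≤ 𝟙 (c ∧ isDom a) + 𝟙 (c ∧ isStal a)
      final-cell false _ = z≤n
      final-cell true {free} a≢free = ⊥-elim (a≢free refl)
      final-cell true {dom} _ = ≤-refl
      final-cell true {stal} _ = ≤-refl

  stalLeaves≤undominated : ∀ β → # stalLeaf β ≤ undominated starOfStars β
  stalLeaves≤undominated β = ∑-mono-≤ (λ x → 𝟙-mono {stalLeaf β x} (¬T⇒T-not ∘ undominated-leaf x)) (allFin N)
    where
    stal≢dom : ∀ c → T (isStal c) → ¬ T (isDom c)
    stal≢dom stal _ ()
    undominated-leaf : ∀ x → T (stalLeaf β x) → ¬ T (dominated starOfStars β x)
    undominated-leaf x x-stalLeaf x-dominated with Equivalence.to T-∨ x-dominated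
    ... | inj₁ x-dom = stal≢dom (β x) (∧-proj₁ {isStal (β x)} (∧-proj₂ {isLeaf x} x-stalLeaf)) x-dom
    ... | inj₂ some-neighbour with satisfied (any⁻ _ (allFin N) some-neighbour)
    ...   | u , x~u∧u-dom = stal≢dom (β (parent x)) (∧-proj₂ {isStal (β x)} (∧-proj₂ {isLeaf x} x-stalLeaf))
            (subst (T ∘ isDom ∘ β)
                   (leaf-neighbour {x} (∧-proj₁ {isLeaf x} x-stalLeaf) (∧-proj₁ {adj starOfStars x u} x~u∧u-dom))
                   (∧-proj₂ {adj starOfStars x u} x~u∧u-dom))

  outcome : ∀ {β} → AllClaimed β → Iˢ β → StallerOutcome β
  outcome {β} done (domLeaves≤ , domCentres≤ , stalCentres*L≤) = # stalCentre β , leaves-bound , centres-bound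
    where
    open ≤-Reasoning
    SL = # stalLeaf β
    s = # stalCentre β
    leaves-bound : s * L ≤ suc b * undominated starOfStars β + b * s + b
    leaves-bound = begin
      s * L                        ≤⟨ stalCentres*L≤ ⟩
      # underStal β                ≤⟨ underStal-final done ⟩
      # domLeaf β + SL             ≤⟨ +-monoˡ-≤ SL domLeaves≤ ⟩
      b * (SL + s) + b + SL        ≡⟨ rearrange b SL s ⟩
      suc b * SL + b * s + b       ≤⟨ +-monoˡ-≤ b (+-monoˡ-≤ (b * s) (*-monoʳ-≤ (suc b) (stalLeaves≤undominated β))) ⟩
      suc b * undominated starOfStars β + b * s + b ∎
      where
      rearrange : ∀ b x s → b * (x + s) + b + x ≡ suc b * x + b * s + b
      rearrange = solve-∀
    centres-bound : k ≤ suc b * s + b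
    centres-bound = begin
      k                            ≤⟨ centres-final done ⟩
      # domCentre β + s            ≤⟨ +-monoˡ-≤ s domCentres≤ ⟩
      b * s + b + s                ≡⟨ rearrange b s ⟩
      suc b * s + b                ∎
      where
      rearrange : ∀ b s → b * s + b + s ≡ suc b * s + b
      rearrange = solve-∀

  staller-ensures : StalEnsures starOfStars b StallerOutcome dominatorTurn emptyBoard
  staller-ensures = stallerEnsures dominator-move staller-move initial
    where
    open Strategy starOfStars b StallerOutcome Iᵈ Iˢ (λ done → outcome done ∘ proj₁) outcome
    nothing≤ : ∀ {p x} → (∀ v → ¬ T (p v)) → # p ≤ x
    nothing≤ no-p = ≤-trans (≤-reflexive (count-none (allFin N) no-p)) z≤n
    no-domLeaf : ∀ {x} → # domLeaf emptyBoard ≤ x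
    no-domLeaf = nothing≤ λ v → ∧-proj₂ {isLeaf v}
    no-domCentre : ∀ {x} → # domCentre emptyBoard ≤ x
    no-domCentre = nothing≤ λ v → ∧-proj₂ {isCentre v}
    initial : Iᵈ emptyBoard
    initial = (no-domLeaf , no-domCentre , ≤-trans (*-monoˡ-≤ L (nothing≤ {x = 0} λ v → ∧-proj₂ {isCentre v})) z≤n)
            , inj₁ no-domCentre , inj₁ no-domLeaf

undominated-fraction : ∀ {Q M n D U} → D + U ≡ n → M * n ≤ Q * M * U + Q * n →
                       D * Q * M ≤ (Q ∸ 1) * M * n + Q * n
undominated-fraction {zero} {M} {n} {D} {U} _ _ rewrite *-zeroʳ D = z≤n
undominated-fraction {suc q} {M} {n} {D} {U} D+U≡n M*n≤ = +-cancelʳ-≤ (U * suc q * M) _ _ (begin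
  D * suc q * M + U * suc q * M          ≡⟨ distrib q M D U ⟩
  q * M * (D + U) + M * (D + U)          ≡⟨ cong (λ x → q * M * x + M * x) D+U≡n ⟩
  q * M * n + M * n                      ≤⟨ +-monoʳ-≤ (q * M * n) M*n≤ ⟩
  q * M * n + (suc q * M * U + suc q * n) ≡⟨ regroup q M n U ⟩
  q * M * n + suc q * n + U * suc q * M  ∎)
  where
  open ≤-Reasoning
  distrib : ∀ q M D U → D * suc q * M + U * suc q * M ≡ q * M * (D + U) + M * (D + U)
  distrib = solve-∀
  regroup : ∀ q M n U → q * M * n + (suc q * M * U + suc q * n) ≡ q * M * n + suc q * n + U * suc q * M
  regroup = solve-∀

square-bound : ∀ b {r s U} → s * (b + r) ≤ suc b * U + b * s + b → b + r ≤ suc b * s + b →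
               r * r ≤ suc b * suc b * U + suc b * b
square-bound b {r} {s} {U} leaves centres = begin
  r * r                        ≤⟨ *-monoˡ-≤ r r≤cs ⟩
  suc b * s * r                ≡⟨ *-assoc (suc b) s r ⟩
  suc b * (s * r)              ≤⟨ *-monoʳ-≤ (suc b) sr≤ ⟩
  suc b * (suc b * U + b)      ≡⟨ distrib b U ⟩
  suc b * suc b * U + suc b * b ∎
  where
  open ≤-Reasoning
  distrib : ∀ b U → suc b * (suc b * U + b) ≡ suc b * suc b * U + suc b * b
  distrib = solve-∀
  split₁ : ∀ b r s → s * (b + r) ≡ b * s + s * r
  split₁ = solve-∀
  split₂ : ∀ b s U → suc b * U + b * s + b ≡ b * s + (suc b * U + b)
  split₂ = solve-∀
  sr≤ : s * r ≤ suc b * U + b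
  sr≤ = +-cancelˡ-≤ (b * s) _ _ (subst₂ _≤_ (split₁ b r s) (split₂ b s U) leaves)
  r≤cs : r ≤ suc b * s
  r≤cs = +-cancelˡ-≤ b _ _ (subst (b + r ≤_) (+-comm _ b) centres)

-- star-arithmetic bounds n by (b+1)² U + slack with slack ≤ slackFactor b · r, so r ≥ (m+1) · slackFactor b
-- makes the slack at most r²/(m+1) ≤ n/(m+1).
slackFactor : ℕ → ℕ
slackFactor b = 2 + 3 * b + b * b + suc b * b

star-arithmetic : ∀ b m r {s U D} → let t = b + r ; n = suc (t * suc t) in
                  suc m * slackFactor b ≤ r → s * t ≤ suc b * U + b * s + b → t ≤ suc b * s + b → D + U ≡ n →
                  D * (b + 1) ^ 2 * suc m ≤ ((b + 1) ^ 2 ∸ 1) * suc m * n + (b + 1) ^ 2 * n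
star-arithmetic b m r {s} {U} {D} r-large leaves centres D+U≡n =
  undominated-fraction {(b + 1) ^ 2} {M} {n} {D} {U} D+U≡n
    (subst (λ Q → M * n ≤ Q * M * U + Q * n) (square b) (begin
    M * n                           ≤⟨ *-monoʳ-≤ M n≤ ⟩
    M * (cc * U + slack)            ≡⟨ distrib M cc U slack ⟩
    cc * M * U + M * slack          ≤⟨ +-monoʳ-≤ (cc * M * U) M*slack≤r*r ⟩
    cc * M * U + r * r              ≤⟨ +-monoʳ-≤ (cc * M * U) (≤-trans r*r≤n (m≤m*n n cc)) ⟩
    cc * M * U + n * cc             ≡⟨ cong (cc * M * U +_) (*-comm n cc) ⟩
    cc * M * U + cc * n             ∎))
  where
  open ≤-Reasoning
  M = suc m
  n = suc ((b + r) * suc (b + r))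
  cc = suc b * suc b
  rest = 1 + b + r + b * b + 2 * b * r
  slack = suc b * b + rest
  square : ∀ b → suc b * suc b ≡ (b + 1) ^ 2
  square b = sym (trans (cong (_^ 2) (+-comm b 1)) (cong (suc b *_) (*-identityʳ (suc b))))
  distrib : ∀ M c U x → M * (c * U + x) ≡ c * M * U + M * x
  distrib = solve-∀
  expand : ∀ b r → suc ((b + r) * suc (b + r)) ≡ r * r + (1 + b + r + b * b + 2 * b * r)
  expand = solve-∀
  r*r≤n : r * r ≤ n
  r*r≤n = subst (r * r ≤_) (sym (expand b r)) (m≤m+n (r * r) rest)
  n≤ : n ≤ cc * U + slack
  n≤ = begin
    n                              ≡⟨ expand b r ⟩
    r * r + rest                   ≤⟨ +-monoˡ-≤ rest (square-bound b leaves centres) ⟩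
    cc * U + suc b * b + rest      ≡⟨ +-assoc (cc * U) _ rest ⟩
    cc * U + slack                 ∎
  1≤r : 1 ≤ r
  1≤r = ≤-trans (s≤s z≤n) r-large
  slack≤ : slack ≤ slackFactor b * r
  slack≤ = begin
    slack                                         ≡⟨ regroup b r ⟩
    (suc b * b + 1 + b + b * b) + (1 + 2 * b) * r
      ≤⟨ +-monoˡ-≤ ((1 + 2 * b) * r) (m≤m*n (suc b * b + 1 + b + b * b) r {{>-nonZero 1≤r}}) ⟩
    (suc b * b + 1 + b + b * b) * r + (1 + 2 * b) * r ≡⟨ factor b r ⟩
    slackFactor b * r                             ∎
    where
    regroup : ∀ b r → suc b * b + (1 + b + r + b * b + 2 * b * r) ≡ (suc b * b + 1 + b + b * b) + (1 + 2 * b) * r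
    regroup = solve-∀
    factor : ∀ b r → (suc b * b + 1 + b + b * b) * r + (1 + 2 * b) * r ≡ (2 + 3 * b + b * b + suc b * b) * r
    factor = solve-∀
  M*slack≤r*r : M * slack ≤ r * r
  M*slack≤r*r = begin
    M * slack                  ≤⟨ *-monoʳ-≤ M slack≤ ⟩
    M * (slackFactor b * r)    ≡⟨ *-assoc M (slackFactor b) r ⟨
    M * slackFactor b * r      ≤⟨ *-monoˡ-≤ r r-large ⟩
    r * r                      ∎

module LargeStarOfStars (b m r : ℕ) (r-large : suc m * slackFactor b ≤ r) where

  open StarOfStars (b + r) (b + r) public
  open StallerOnStarOfStars (b + r) (b + r) b

  r≤N : r ≤ N
  r≤N = ≤-trans (m≤n+m r b) k≤N

  FewDominated : Board N → Set
  FewDominated β = domCount starOfStars β * (b + 1) ^ 2 * suc m ≤ ((b + 1) ^ 2 ∸ 1) * suc m * N + (b + 1) ^ 2 * N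

  staller-bound : StalEnsures starOfStars b FewDominated dominatorTurn emptyBoard
  staller-bound = StalEnsures-map few-dominated staller-ensures
    where
    few-dominated : ∀ {β} → StallerOutcome β → FewDominated β
    few-dominated {β} (s , leaves , centres) =
      star-arithmetic b m r {s} {undominated starOfStars β} {domCount starOfStars β} r-large leaves centres
                      (domCount+undominated starOfStars β)

theorem1p6 : (b : ℕ) → 1 ≤ b →
    ((n : ℕ) (G : Graph n) → IsTree G →
      DomEnsures G b
        (λ β → ((b + 1) ^ 2 ∸ 1) * n ≤ domCount G β * (b + 1) ^ 2)
        dominatorTurn emptyBoard)
    ×
    ((m N : ℕ) → Σ ℕ (λ n → N ≤ n × Σ (Graph n) (λ G → IsTree G ×
      StalEnsures G b
        (λ β → domCount G β * (b + 1) ^ 2 * suc m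
               ≤ ((b + 1) ^ 2 ∸ 1) * suc m * n + (b + 1) ^ 2 * n)
        dominatorTurn emptyBoard)))
theorem1p6 b 1≤b = tree-domination b 1≤b , λ m N₀ →
  let open LargeStarOfStars b m (suc m * slackFactor b + N₀) (m≤m+n _ N₀)
  in N , ≤-trans (m≤n+m N₀ _) r≤N , starOfStars , isTree , staller-bound
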